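{- Let $G=K_n^{n_1,n_2,\ldots,n_k}$ where $k\geq 2$, $n_1,\dots,n_k$ are positive integers and $n=\sum_{i=1}^k n_i+1$. Then the distance characteristic polynomial $P_D(\lambda)=\det(\lambda I-D(G))$ is $$P_{D}(\lambda)=(\lambda+1)^{n-k-1}\left(\lambda-\sum_{i=1}^{k}\frac{n_{i}(2\lambda+1)}{\lambda+n_{i}+1}\right)\prod_{i=1}^{k}(\lambda+n_{i}+1).$$
   Context: All graphs are simple, undirected and connected. $D(G)$ is the distance matrix of $G$ (entries are shortest-path distances). For $k\geq 2$ and positive integers $n_1,\dots,n_k$ with $n=\sum n_i+1$, $K_n^{n_1,\ldots,n_k}$ is the graph with a vertex $v$ of degree $n-1$ such that $G-v$ is the disjoint union of complete graphs $K_{n_1},\dots,K_{n_k}$. -}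

module Defs where

open import Data.Nat as ℕ using (ℕ; zero; suc; _∸_)
open import Data.Bool using (Bool; true; false; _∧_; _∨_; not; if_then_else_)
open import Data.Fin using (Fin; zero; suc; toℕ; punchIn)
open import Data.List using (List; []; _∷_; length)
open import Data.Nat.ListAction using (sum)
open import Data.List.Relation.Unary.All using (All; []; _∷_)
open import Data.Integer using (+_)
open import Data.Rational using (ℚ; 0ℚ; 1ℚ; _+_; _*_; _-_; -_; _÷_; ≢-nonZero)
open import Relation.Nullary using (Dec; yes; no; does)
open import Relation.Binary.PropositionalEquality using (_≢_)

anyFin : ∀ {N} → (Fin N → Bool) → Bool
anyFin {zero}  f = false
anyFin {suc N} f = f zero ∨ anyFin (λ i → f (suc i))

reach : ∀ {N} → (Fin N → Fin N → Bool) → ℕ → Fin N → Fin N → Bool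
reach adj zero    u v = does (u Data.Fin.≟ v)
reach adj (suc t) u v = reach adj t u v ∨ anyFin (λ w → reach adj t u w ∧ adj w v)

-- least t < bound with reach t u v, searching from t = s; returns bound if none
-- (never happens in a connected graph on N vertices with bound = N).
searchDist : ∀ {N} → (Fin N → Fin N → Bool) → Fin N → Fin N → ℕ → ℕ → ℕ
searchDist adj u v s zero      = s
searchDist adj u v s (suc fuel) =
  if reach adj s u v then s else searchDist adj u v (suc s) fuel

dist : ∀ {N} → (Fin N → Fin N → Bool) → Fin N → Fin N → ℕ
dist {N} adj u v = searchDist adj u v 0 N

-- The graph K_n^{n_1,...,n_k}.
-- ns = [n_1, ..., n_k]; vertex set Fin (suc (sum ns)); vertex 0 is the
-- dominating vertex v; vertex (suc j), j = 0 .. sum ns - 1, lies in clique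
-- number (block ns j), the cliques being consecutive intervals of sizes n_i.

block : List ℕ → ℕ → ℕ
block []       j = 0
block (m ∷ ms) j = if does (suc j ℕ.≤? m) then 0 else suc (block ms (j ∸ m))

adjK : (ns : List ℕ) → Fin (suc (sum ns)) → Fin (suc (sum ns)) → Bool
adjK ns zero    zero    = false
adjK ns zero    (suc j) = true
adjK ns (suc i) zero    = true
adjK ns (suc i) (suc j) =
  not (does (i Data.Fin.≟ j)) ∧ does (block ns (toℕ i) ℕ.≟ block ns (toℕ j))

ℕtoℚ : ℕ → ℚ
ℕtoℚ m = (+ m) Data.Rational./ 1

_^ᵠ_ : ℚ → ℕ → ℚ
x ^ᵠ zero  = 1ℚ
x ^ᵠ suc m = x * (x ^ᵠ m)

sumFin : ∀ {N} → (Fin N → ℚ) → ℚ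
sumFin {zero}  f = 0ℚ
sumFin {suc N} f = f zero + sumFin (λ i → f (suc i))

signℚ : ℕ → ℚ
signℚ zero    = 1ℚ
signℚ (suc m) = - signℚ m

det : ∀ N → (Fin N → Fin N → ℚ) → ℚ
det zero    A = 1ℚ
det (suc N) A =
  sumFin (λ j → signℚ (toℕ j) * A zero j * det N (λ r c → A (suc r) (punchIn j c)))

DK : (ns : List ℕ) → Fin (suc (sum ns)) → Fin (suc (sum ns)) → ℚ
DK ns u v = ℕtoℚ (dist (adjK ns) u v)

charPolyD : (ns : List ℕ) → ℚ → ℚ
charPolyD ns λ' = det (suc (sum ns))
  (λ u v → (if does (u Data.Fin.≟ v) then λ' else 0ℚ) - DK ns u v)

Pole : ℚ → ℕ → Set
Pole λ' m = λ' + ℕtoℚ m + 1ℚ ≢ 0ℚ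

fracSum : (λ' : ℚ) (ns : List ℕ) → All (Pole λ') ns → ℚ
fracSum λ' []       []         = 0ℚ
fracSum λ' (m ∷ ms) (p ∷ ps) =
  _÷_ (ℕtoℚ m * (ℕtoℚ 2 * λ' + 1ℚ)) (λ' + ℕtoℚ m + 1ℚ) {{≢-nonZero p}}
  + fracSum λ' ms ps

prodPoles : ℚ → List ℕ → ℚ
prodPoles λ' []       = 1ℚ
prodPoles λ' (m ∷ ms) = (λ' + ℕtoℚ m + 1ℚ) * prodPoles λ' ms

module Submission where

-- Write M = λI − D(G) with the dominating vertex first, and call the first
-- vertex of each clique its leader. Subtracting twice column 0 from the other
-- columns, and then from every non-leader column j the column of its leader,
-- turns column j into (λ+1)(e_j − e_{leader j}); pulling these factors out gives
-- (λ+1)^{n−k−1}. These columns clear the non-leader rows of column 0 and of the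
-- leader columns, after which the leader column of clique i has −(2λ+1) in
-- row 0 and λ+n_i+1 on the diagonal, while column 0 has −n_i in that row.
-- Adding n_i/(λ+n_i+1) times each leader column to column 0 leaves an upper
-- triangular matrix with diagonal λ − Σ n_i(2λ+1)/(λ+n_i+1), the λ+n_i+1, and 1s.

open import Defs

module Determinant where

  open import Data.Nat as ℕ using (ℕ; zero; suc)
  import Data.Nat.Properties as ℕP
  open import Data.Fin as F using (Fin; zero; suc; toℕ; punchIn; punchOut; inject₁)
  open import Data.Fin.Properties
    using (toℕ<n; toℕ-fromℕ<; punchInᵢ≢i; punchIn-injective; punchIn-punchOut; toℕ-inject₁; toℕ-injective; suc-injective)
  open import Data.Bool using (Bool; true; false; if_then_else_)
  open import Data.Product using (Σ; _×_; _,_)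
  open import Data.Sum using (_⊎_; inj₁; inj₂)
  open import Data.Rational using (ℚ; 0ℚ; 1ℚ; _+_; _*_; _-_; -_)
  open import Data.Rational.Properties
  open import Data.Rational.Solver using (module +-*-Solver)
  open import Relation.Binary.PropositionalEquality
  open import Relation.Binary.Definitions using (tri<; tri≈; tri>)
  open import Relation.Nullary using (Dec; yes; no; does)
  open import Relation.Nullary.Decidable using (dec-true; dec-false)
  open import Data.Empty using (⊥-elim)
  open import Function using (_∘′_; case_of_)
  open +-*-Solver

  Mat : ℕ → Set
  Mat N = Fin N → Fin N → ℚ

  prodFin : ∀ {N} → (Fin N → ℚ) → ℚ
  prodFin {zero}  f = 1ℚ
  prodFin {suc N} f = f zero * prodFin (λ i → f (suc i))

  sumFin-cong : ∀ {N} {f g : Fin N → ℚ} → (∀ i → f i ≡ g i) → sumFin f ≡ sumFin g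
  sumFin-cong {zero}  h = refl
  sumFin-cong {suc N} h = cong₂ _+_ (h zero) (sumFin-cong (λ i → h (suc i)))

  sumFin-zero : ∀ {N} {f : Fin N → ℚ} → (∀ i → f i ≡ 0ℚ) → sumFin f ≡ 0ℚ
  sumFin-zero {zero}  h = refl
  sumFin-zero {suc N} h = cong₂ _+_ (h zero) (sumFin-zero (λ i → h (suc i)))

  sumFin-+ : ∀ {N} (f g : Fin N → ℚ) → sumFin (λ i → f i + g i) ≡ sumFin f + sumFin g
  sumFin-+ {zero}  f g = refl
  sumFin-+ {suc N} f g =
    trans (cong (f zero + g zero +_) (sumFin-+ (λ i → f (suc i)) (λ i → g (suc i))))
          (solve 4 (λ a b c d → (a :+ b) :+ (c :+ d) := (a :+ c) :+ (b :+ d)) refl (f zero) (g zero) _ _)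

  sumFin-*ˡ : ∀ {N} (t : ℚ) (f : Fin N → ℚ) → sumFin (λ i → t * f i) ≡ t * sumFin f
  sumFin-*ˡ {zero}  t f = sym (*-zeroʳ t)
  sumFin-*ˡ {suc N} t f =
    trans (cong (t * f zero +_) (sumFin-*ˡ t (λ i → f (suc i)))) (sym (*-distribˡ-+ t (f zero) _))

  minor : ∀ {N} → Mat (suc N) → Fin (suc N) → Mat N
  minor A j r c = A (suc r) (punchIn j c)

  cofactorTerm : ∀ {N} → Mat (suc N) → Fin (suc N) → ℚ
  cofactorTerm {N} A j = signℚ (toℕ j) * A zero j * det N (minor A j)

  det-cong : ∀ N {A B : Mat N} → (∀ r c → A r c ≡ B r c) → det N A ≡ det N B
  det-cong zero    h = refl
  det-cong (suc N) h = sumFin-cong λ j →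
    cong₂ _*_ (cong (signℚ (toℕ j) *_) (h zero j)) (det-cong N (λ r c → h (suc r) (punchIn j c)))

  det-linear-column : ∀ N (A B C : Mat N) (c : Fin N) (t : ℚ) →
    (∀ r k → k ≢ c → A r k ≡ B r k) → (∀ r k → k ≢ c → A r k ≡ C r k) →
    (∀ r → A r c ≡ B r c + t * C r c) → det N A ≡ det N B + t * det N C
  det-linear-column (suc N) A B C c t hB hC hc =
    trans (sumFin-cong term)
      (trans (sumFin-+ (cofactorTerm B) (λ j → t * cofactorTerm C j))
             (cong (sumFin (cofactorTerm B) +_) (sumFin-*ˡ t (cofactorTerm C))))
    where
    term : ∀ j → cofactorTerm A j ≡ cofactorTerm B j + t * cofactorTerm C j
    term j with j F.≟ c
    ... | yes refl =
      trans (cong₂ (λ a d → s * a * d) (hc zero) (det-cong N (λ r k → hB (suc r) (punchIn j k) (punchInᵢ≢i j k))))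
        (trans (solve 5 (λ s b tt cc d → s :* (b :+ tt :* cc) :* d := s :* b :* d :+ tt :* (s :* cc :* d))
                   refl s (B zero j) t (C zero j) (det N (minor B j)))
               (cong (λ d → cofactorTerm B j + t * (s * C zero j * d))
                     (det-cong N (λ r k → trans (sym (hB (suc r) (punchIn j k) (punchInᵢ≢i j k)))
                                                (hC (suc r) (punchIn j k) (punchInᵢ≢i j k))))))
      where s = signℚ (toℕ j)
    ... | no j≢c =
      trans (cong₂ (λ a d → s * a * d) (hB zero j j≢c) minor-linear)
        (trans (solve 5 (λ s b tt d e → s :* b :* (d :+ tt :* e) := s :* b :* d :+ tt :* (s :* b :* e))
                   refl s (B zero j) t (det N (minor B j)) (det N (minor C j)))
               (cong (λ b → cofactorTerm B j + t * (s * b * det N (minor C j)))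
                     (trans (sym (hB zero j j≢c)) (hC zero j j≢c))))
      where
      s = signℚ (toℕ j)
      c′ = punchOut j≢c
      avoids-c : ∀ k → k ≢ c′ → punchIn j k ≢ c
      avoids-c k k≢c′ e = k≢c′ (punchIn-injective j k c′ (trans e (sym (punchIn-punchOut j≢c))))
      minor-linear : det N (minor A j) ≡ det N (minor B j) + t * det N (minor C j)
      minor-linear = det-linear-column N (minor A j) (minor B j) (minor C j) c′ t
        (λ r k k≢ → hB (suc r) (punchIn j k) (avoids-c k k≢))
        (λ r k k≢ → hC (suc r) (punchIn j k) (avoids-c k k≢))
        (λ r → subst (λ k → A (suc r) k ≡ B (suc r) k + t * C (suc r) k) (sym (punchIn-punchOut j≢c)) (hc (suc r)))

  det-zero-column : ∀ N (A : Mat N) (c : Fin N) → (∀ r → A r c ≡ 0ℚ) → det N A ≡ 0ℚ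
  det-zero-column N A c h = begin
      d                 ≡⟨ solve 1 (λ d → d := (d :+ con 1ℚ :* d) :- d) refl d ⟩
      (d + 1ℚ * d) - d  ≡⟨ cong (_- d) (sym d≡2d) ⟩
      d - d             ≡⟨ +-inverseʳ d ⟩
      0ℚ                ∎
    where
    open ≡-Reasoning
    d = det N A
    d≡2d : d ≡ d + 1ℚ * d
    d≡2d = det-linear-column N A A A c 1ℚ (λ _ _ _ → refl) (λ _ _ _ → refl)
             (λ r → trans (h r) (sym (trans (cong₂ (λ u v → u + 1ℚ * v) (h r) (h r)) refl)))

  private
    punchIn-avoiding-pair : ∀ {M} (j : Fin (suc (suc M))) (p : Fin (suc M)) → j ≢ inject₁ p → j ≢ suc p →
      Σ (Fin M) λ q → (punchIn j (inject₁ q) ≡ inject₁ p) × (punchIn j (suc q) ≡ suc p)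
    punchIn-avoiding-pair zero zero j≢p _ = ⊥-elim (j≢p refl)
    punchIn-avoiding-pair {suc M} zero (suc p) _ _ = p , refl , refl
    punchIn-avoiding-pair (suc zero) zero _ j≢p+1 = ⊥-elim (j≢p+1 refl)
    punchIn-avoiding-pair {suc M} (suc (suc j)) zero _ _ = zero , refl , refl
    punchIn-avoiding-pair {suc M} (suc j) (suc p) j≢p j≢p+1
      with punchIn-avoiding-pair j p (j≢p ∘′ cong suc) (j≢p+1 ∘′ cong suc)
    ... | q , e₁ , e₂ = suc q , cong suc e₁ , cong suc e₂

    punchIn-pair : ∀ {N} (p k : Fin N) →
      punchIn (inject₁ p) k ≡ punchIn (suc p) k ⊎ (punchIn (inject₁ p) k ≡ suc p × punchIn (suc p) k ≡ inject₁ p)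
    punchIn-pair zero    zero    = inj₂ (refl , refl)
    punchIn-pair zero    (suc k) = inj₁ refl
    punchIn-pair (suc p) zero    = inj₁ refl
    punchIn-pair (suc p) (suc k) with punchIn-pair p k
    ... | inj₁ e         = inj₁ (cong suc e)
    ... | inj₂ (e₁ , e₂) = inj₂ (cong suc e₁ , cong suc e₂)

    sumFin-pair : ∀ {M} (f : Fin (suc (suc M)) → ℚ) (p : Fin (suc M)) →
      (∀ j → j ≢ inject₁ p → j ≢ suc p → f j ≡ 0ℚ) → f (inject₁ p) + f (suc p) ≡ 0ℚ → sumFin f ≡ 0ℚ
    sumFin-pair f zero h e =
      trans (cong (λ z → f zero + (f (suc zero) + z)) (sumFin-zero (λ i → h (suc (suc i)) (λ ()) (λ ()))))
        (trans (solve 2 (λ a b → a :+ (b :+ con 0ℚ) := a :+ b) refl (f zero) (f (suc zero))) e)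
    sumFin-pair {suc M} f (suc p) h e =
      cong₂ _+_ (h zero (λ ()) (λ ()))
        (sumFin-pair (λ i → f (suc i)) p (λ j j≢p j≢p+1 → h (suc j) (j≢p ∘′ suc-injective) (j≢p+1 ∘′ suc-injective)) e)

  det-adjacent-equal-columns : ∀ N (A : Mat (suc N)) (p : Fin N) →
    (∀ r → A r (inject₁ p) ≡ A r (suc p)) → det (suc N) A ≡ 0ℚ
  det-adjacent-equal-columns (suc N) A p h = sumFin-pair (cofactorTerm A) p others pair
    where
    others : ∀ j → j ≢ inject₁ p → j ≢ suc p → cofactorTerm A j ≡ 0ℚ
    others j j≢p j≢p+1 with punchIn-avoiding-pair j p j≢p j≢p+1
    ... | q , e₁ , e₂ =
      trans (cong (signℚ (toℕ j) * A zero j *_)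
              (det-adjacent-equal-columns N (minor A j) q
                (λ r → trans (cong (A (suc r)) e₁) (trans (h (suc r)) (cong (A (suc r)) (sym e₂))))))
            (*-zeroʳ (signℚ (toℕ j) * A zero j))
    same-minor : ∀ r k → minor A (inject₁ p) r k ≡ minor A (suc p) r k
    same-minor r k with punchIn-pair p k
    ... | inj₁ e         = cong (A (suc r)) e
    ... | inj₂ (e₁ , e₂) = trans (cong (A (suc r)) e₁) (trans (sym (h (suc r))) (cong (A (suc r)) (sym e₂)))
    -- the two cofactor terms carry opposite signs and equal minors
    pair : cofactorTerm A (inject₁ p) + cofactorTerm A (suc p) ≡ 0ℚ
    pair = trans (cong₂ (λ s d → signℚ s * A zero (inject₁ p) * d + cofactorTerm A (suc p))
                        (toℕ-inject₁ p) (det-cong (suc N) same-minor))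
             (trans (cong (λ a → signℚ (toℕ p) * a * d + (- signℚ (toℕ p)) * A zero (suc p) * d) (h zero))
                    (solve 3 (λ s a d → s :* a :* d :+ (:- s) :* a :* d := con 0ℚ) refl (signℚ (toℕ p)) (A zero (suc p)) d))
      where d = det (suc N) (minor A (suc p))

  setColumn : ∀ {N} → Mat N → Fin N → (Fin N → ℚ) → Mat N
  setColumn A c v r k = if does (k F.≟ c) then v r else A r k

  module _ {N} (A : Mat N) (c : Fin N) (v : Fin N → ℚ) (r : Fin N) where

    setColumn-same : setColumn A c v r c ≡ v r
    setColumn-same rewrite dec-true (c F.≟ c) refl = refl

    setColumn-other : ∀ {k} → k ≢ c → setColumn A c v r k ≡ A r k
    setColumn-other {k} k≢c rewrite dec-false (k F.≟ c) k≢c = refl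

  setColumn-column : ∀ {N} (A : Mat N) c r k → setColumn A c (λ r → A r c) r k ≡ A r k
  setColumn-column A c r k with k F.≟ c
  ... | yes refl = refl
  ... | no _     = refl

  setColumn-comm : ∀ {N} (A : Mat N) {a b} → a ≢ b → ∀ u v r k →
    setColumn (setColumn A b v) a u r k ≡ setColumn (setColumn A a u) b v r k
  setColumn-comm A {a} {b} a≢b u v r k with k F.≟ a | k F.≟ b
  ... | yes refl | yes refl = ⊥-elim (a≢b refl)
  ... | yes refl | no _     = refl
  ... | no _     | yes _    = refl
  ... | no _     | no _     = refl

  det-setColumn-linear : ∀ N (A : Mat N) c (u v : Fin N → ℚ) (t : ℚ) →
    det N (setColumn A c (λ r → u r + t * v r)) ≡ det N (setColumn A c u) + t * det N (setColumn A c v)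
  det-setColumn-linear N A c u v t = det-linear-column N _ _ _ c t
    (λ r k k≢c → trans (setColumn-other A c w r k≢c) (sym (setColumn-other A c u r k≢c)))
    (λ r k k≢c → trans (setColumn-other A c w r k≢c) (sym (setColumn-other A c v r k≢c)))
    (λ r → trans (setColumn-same A c w r)
                 (sym (cong₂ (λ x y → x + t * y) (setColumn-same A c u r) (setColumn-same A c v r))))
    where
    w : Fin N → ℚ
    w r = u r + t * v r

  swapColumns : ∀ {N} → Mat N → Fin N → Fin N → Mat N
  swapColumns A a b = setColumn (setColumn A b (λ r → A r a)) a (λ r → A r b)

  inject₁≢suc : ∀ {N} (p : Fin N) → inject₁ p ≢ suc p
  inject₁≢suc p e = ℕP.1+n≢n (sym (trans (sym (toℕ-inject₁ p)) (cong toℕ e)))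

  -- Swapping is antisymmetric because the determinant, viewed as a function of
  -- the two columns, is bilinear and vanishes on equal arguments.
  det-swap-adjacent-columns : ∀ N (A : Mat (suc N)) (p : Fin N) →
    det (suc N) (swapColumns A (inject₁ p) (suc p)) ≡ - det (suc N) A
  det-swap-adjacent-columns N A p = begin
      det n B                                                       ≡⟨ solve 2 (λ x y → y := (x :+ y) :- x) refl (det n A) (det n B) ⟩
      (det n A + det n B) - det n A                                 ≡⟨ cong (_- det n A) sum≡0 ⟩
      0ℚ - det n A                                                  ≡⟨ +-identityˡ (- det n A) ⟩
      - det n A                                                     ∎
    where
    open ≡-Reasoning
    n = suc N
    a = inject₁ p
    b = suc p
    a≢b = inject₁≢suc p
    B = swapColumns A a b
    Aa Ab : Fin n → ℚ
    Aa r = A r a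
    Ab r = A r b
    Δ : (Fin n → ℚ) → (Fin n → ℚ) → ℚ
    Δ u v = det n (setColumn (setColumn A b v) a u)
    linear₁ : ∀ u w v → Δ (λ r → u r + 1ℚ * w r) v ≡ Δ u v + 1ℚ * Δ w v
    linear₁ u w v = det-setColumn-linear n (setColumn A b v) a u w 1ℚ
    linear₂ : ∀ u v w → Δ u (λ r → v r + 1ℚ * w r) ≡ Δ u v + 1ℚ * Δ u w
    linear₂ u v w =
      trans (det-cong n (setColumn-comm A a≢b u (λ r → v r + 1ℚ * w r)))
        (trans (det-setColumn-linear n (setColumn A a u) b v w 1ℚ)
               (sym (cong₂ (λ x y → x + 1ℚ * y) (det-cong n (setColumn-comm A a≢b u v))
                                                   (det-cong n (setColumn-comm A a≢b u w)))))
    alternating : ∀ u → Δ u u ≡ 0ℚ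
    alternating u = det-adjacent-equal-columns N (setColumn (setColumn A b u) a u) p (λ r →
      trans (setColumn-same (setColumn A b u) a u r)
            (sym (trans (setColumn-other (setColumn A b u) a u r (a≢b ∘′ sym)) (setColumn-same A b u r))))
    Δab≡detA : Δ Aa Ab ≡ det n A
    Δab≡detA = det-cong n λ r k → trans (setColumn-comm A a≢b Aa Ab r k) (unchanged r k)
      where
      unchanged : ∀ r k → setColumn (setColumn A a Aa) b Ab r k ≡ A r k
      unchanged r k with k F.≟ b
      ... | yes refl = refl
      ... | no _     = setColumn-column A a r k
    s : Fin n → ℚ
    s r = Aa r + 1ℚ * Ab r
    sum≡0 : det n A + det n B ≡ 0ℚ
    sum≡0 = sym (begin
      0ℚ                                                          ≡⟨ sym (alternating s) ⟩
      Δ s s                                                       ≡⟨ linear₁ Aa Ab s ⟩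
      Δ Aa s + 1ℚ * Δ Ab s                                        ≡⟨ cong₂ (λ x y → x + 1ℚ * y) (linear₂ Aa Aa Ab) (linear₂ Ab Aa Ab) ⟩
      (Δ Aa Aa + 1ℚ * Δ Aa Ab) + 1ℚ * (Δ Ab Aa + 1ℚ * Δ Ab Ab)   ≡⟨ cong₂ (λ w z → (w + 1ℚ * Δ Aa Ab) + 1ℚ * (Δ Ab Aa + 1ℚ * z)) (alternating Aa) (alternating Ab) ⟩
      (0ℚ + 1ℚ * Δ Aa Ab) + 1ℚ * (Δ Ab Aa + 1ℚ * 0ℚ)             ≡⟨ solve 2 (λ x y → (con 0ℚ :+ con 1ℚ :* x) :+ con 1ℚ :* (y :+ con 1ℚ :* con 0ℚ) := x :+ y) refl (Δ Aa Ab) (Δ Ab Aa) ⟩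
      Δ Aa Ab + det n B                                           ≡⟨ cong (_+ det n B) Δab≡detA ⟩
      det n A + det n B                                           ∎)

  private
    det-equal-columns-at-distance : ∀ d {N} (A : Mat (suc N)) (a : Fin (suc N)) (p : Fin N) →
      toℕ p ≡ d ℕ.+ toℕ a → (∀ r → A r a ≡ A r (suc p)) → det (suc N) A ≡ 0ℚ
    det-equal-columns-at-distance zero {N} A a p p≡a h =
      det-adjacent-equal-columns N A p (λ r → subst (λ k → A r k ≡ A r (suc p)) a≡p (h r))
      where
      a≡p : a ≡ inject₁ p
      a≡p = toℕ-injective (trans (sym p≡a) (sym (toℕ-inject₁ p)))
    det-equal-columns-at-distance (suc d) {suc N} A a (suc p) p≡a h =
      neg-injective (trans (sym (det-swap-adjacent-columns (suc N) A (suc p))) swapped≡0)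
      where
      a₁ = inject₁ (suc p)
      a₂ = suc (suc p)
      p≡a′ : toℕ p ≡ d ℕ.+ toℕ a
      p≡a′ = ℕP.suc-injective p≡a
      a≢a₁ : a ≢ a₁
      a≢a₁ e = ℕP.m≢1+n+m (toℕ a) (trans (cong toℕ e) (trans (toℕ-inject₁ (suc p)) (cong suc p≡a′)))
      a≢a₂ : a ≢ a₂
      a≢a₂ e = ℕP.m≢1+n+m (toℕ a) (trans (cong toℕ e) (cong (λ z → suc (suc z)) p≡a′))
      B = swapColumns A a₁ a₂
      swapped≡0 : det (suc (suc N)) B ≡ 0ℚ
      swapped≡0 = det-equal-columns-at-distance d B a (inject₁ p) (trans (toℕ-inject₁ p) p≡a′) λ r →
        trans (setColumn-other (setColumn A a₂ (λ r → A r a₁)) a₁ (λ r → A r a₂) r a≢a₁)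
          (trans (setColumn-other A a₂ (λ r → A r a₁) r a≢a₂)
            (trans (h r) (sym (setColumn-same (setColumn A a₂ (λ r → A r a₁)) a₁ (λ r → A r a₂) r))))

    det-equal-columns-ordered : ∀ {N} (A : Mat N) (a b : Fin N) → toℕ a ℕ.< toℕ b →
      (∀ r → A r a ≡ A r b) → det N A ≡ 0ℚ
    det-equal-columns-ordered {suc N} A a (suc p) (ℕ.s≤s a≤p) =
      det-equal-columns-at-distance (toℕ p ℕ.∸ toℕ a) A a p (sym (ℕP.m∸n+n≡m a≤p))

  det-equal-columns : ∀ N (A : Mat N) (a b : Fin N) → a ≢ b → (∀ r → A r a ≡ A r b) → det N A ≡ 0ℚ
  det-equal-columns N A a b a≢b h with ℕ.<-cmp (toℕ a) (toℕ b)
  ... | tri< a<b _ _ = det-equal-columns-ordered A a b a<b h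
  ... | tri≈ _ e _   = ⊥-elim (a≢b (toℕ-injective e))
  ... | tri> _ _ b<a = det-equal-columns-ordered A b a b<a (λ r → sym (h r))

  setColumn-cong : ∀ {N} (A : Mat N) c {u v : Fin N → ℚ} → (∀ r → u r ≡ v r) →
    ∀ r k → setColumn A c u r k ≡ setColumn A c v r k
  setColumn-cong A c u≡v r k with k F.≟ c
  ... | yes _ = u≡v r
  ... | no _  = refl

  det-setColumn-combination : ∀ M N (A : Mat N) c (u : Fin N → ℚ) (w : Fin M → ℚ) (v : Fin M → Fin N → ℚ) →
    det N (setColumn A c (λ r → u r + sumFin (λ i → w i * v i r)))
      ≡ det N (setColumn A c u) + sumFin (λ i → w i * det N (setColumn A c (v i)))
  det-setColumn-combination zero N A c u w v =
    trans (det-cong N (setColumn-cong A c (λ r → +-identityʳ (u r)))) (sym (+-identityʳ _))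
  det-setColumn-combination (suc M) N A c u w v = begin
      det N (setColumn A c (λ r → u r + (w zero * v zero r + S r)))
        ≡⟨ det-cong N (setColumn-cong A c (λ r → sym (+-assoc (u r) (w zero * v zero r) (S r)))) ⟩
      det N (setColumn A c (λ r → u′ r + S r))
        ≡⟨ det-setColumn-combination M N A c u′ (λ i → w (suc i)) (λ i → v (suc i)) ⟩
      det N (setColumn A c u′) + R
        ≡⟨ cong (_+ R) (det-setColumn-linear N A c u (v zero) (w zero)) ⟩
      (det N (setColumn A c u) + w zero * det N (setColumn A c (v zero))) + R
        ≡⟨ +-assoc (det N (setColumn A c u)) (w zero * det N (setColumn A c (v zero))) R ⟩
      det N (setColumn A c u) + (w zero * det N (setColumn A c (v zero)) + R) ∎
    where
    open ≡-Reasoning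
    S : Fin N → ℚ
    S r = sumFin (λ i → w (suc i) * v (suc i) r)
    u′ : Fin N → ℚ
    u′ r = u r + w zero * v zero r
    R = sumFin (λ i → w (suc i) * det N (setColumn A c (v (suc i))))

  det-add-column-combination : ∀ N (A B : Mat N) (c : Fin N) (t : Fin N → ℚ) → t c ≡ 0ℚ →
    (∀ r k → k ≢ c → B r k ≡ A r k) → (∀ r → B r c ≡ A r c + sumFin (λ k → t k * A r k)) →
    det N B ≡ det N A
  det-add-column-combination N A B c t tc≡0 hB hc = begin
      det N B
        ≡⟨ det-cong N B≡ ⟩
      det N (setColumn A c (λ r → A r c + sumFin (λ k → t k * A r k)))
        ≡⟨ det-setColumn-combination N N A c (λ r → A r c) t (λ k r → A r k) ⟩
      det N (setColumn A c (λ r → A r c)) + sumFin (λ k → t k * det N (setColumn A c (λ r → A r k)))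
        ≡⟨ cong₂ _+_ (det-cong N (setColumn-column A c)) (sumFin-zero vanishing) ⟩
      det N A + 0ℚ
        ≡⟨ +-identityʳ (det N A) ⟩
      det N A ∎
    where
    open ≡-Reasoning
    B≡ : ∀ r k → B r k ≡ setColumn A c (λ r → A r c + sumFin (λ k → t k * A r k)) r k
    B≡ r k with k F.≟ c
    ... | yes refl = hc r
    ... | no k≢c   = hB r k k≢c
    vanishing : ∀ k → t k * det N (setColumn A c (λ r → A r k)) ≡ 0ℚ
    vanishing k with k F.≟ c
    ... | yes refl = trans (cong (_* det N (setColumn A k (λ r → A r k))) tc≡0) (*-zeroˡ (det N (setColumn A k (λ r → A r k))))
    ... | no k≢c   = trans (cong (t k *_) (det-equal-columns N (setColumn A c (λ r → A r k)) c k (k≢c ∘′ sym)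
                       (λ r → trans (setColumn-same A c (λ r → A r k) r) (sym (setColumn-other A c (λ r → A r k) r k≢c)))))
                       (*-zeroʳ (t k))

  -- The operations are performed one column at a time, left to right; the kept
  -- columns never change, so every intermediate step is a single
  -- det-add-column-combination.
  det-add-kept-column-combinations : ∀ N (A B : Mat N) (kept : Fin N → Bool) (t : Fin N → Fin N → ℚ) →
    (∀ c k → kept k ≡ false → t c k ≡ 0ℚ) →
    (∀ r c → kept c ≡ true → B r c ≡ A r c) →
    (∀ r c → kept c ≡ false → B r c ≡ A r c + sumFin (λ k → t c k * A r k)) →
    det N B ≡ det N A
  det-add-kept-column-combinations N A B kept t t≡0 hkept hchanged =
    trans (det-cong N B≡updated) (updated-det N)
    where
    choose : ∀ {P : Set} → Dec P → ℚ → ℚ → ℚ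
    choose (yes _) x y = x
    choose (no _)  x y = y

    updated : ℕ → Mat N
    updated m r c = choose (toℕ c ℕ.<? m) (B r c) (A r c)

    B≡updated : ∀ r c → B r c ≡ updated N r c
    B≡updated r c with toℕ c ℕ.<? N
    ... | yes _  = refl
    ... | no c≮N = ⊥-elim (c≮N (toℕ<n c))

    updated-other : ∀ m r c → toℕ c ≢ m → updated (suc m) r c ≡ updated m r c
    updated-other m r c c≢m with toℕ c ℕ.<? suc m | toℕ c ℕ.<? m
    ... | yes _           | yes _  = refl
    ... | no _            | no _   = refl
    ... | yes (ℕ.s≤s c≤m) | no c≮m = ⊥-elim (c≢m (ℕP.≤-antisym c≤m (ℕP.≮⇒≥ c≮m)))
    ... | no c≮1+m        | yes c<m = ⊥-elim (c≮1+m (ℕP.m<n⇒m<1+n c<m))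

    updated-new : ∀ m r c → toℕ c ≡ m → updated (suc m) r c ≡ B r c
    updated-new m r c refl with toℕ c ℕ.<? suc (toℕ c)
    ... | yes _  = refl
    ... | no c≮c = ⊥-elim (c≮c ℕP.≤-refl)

    updated-old : ∀ m r c → toℕ c ≡ m → updated m r c ≡ A r c
    updated-old m r c refl with toℕ c ℕ.<? toℕ c
    ... | yes c<c = ⊥-elim (ℕP.<-irrefl refl c<c)
    ... | no _    = refl

    updated-kept : ∀ m r k → kept k ≡ true → updated m r k ≡ A r k
    updated-kept m r k kept-k with toℕ k ℕ.<? m
    ... | yes _ = hkept r k kept-k
    ... | no _  = refl

    step : ∀ m → det N (updated (suc m)) ≡ det N (updated m)
    step m with m ℕ.<? N
    ... | no m≮N = det-cong N (λ r c → updated-other m r c (λ c≡m → m≮N (subst (ℕ._< N) c≡m (toℕ<n c))))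
    ... | yes m<N = step-at (kept c₀) refl
      where
      c₀ = F.fromℕ< m<N
      c₀≡m : toℕ c₀ ≡ m
      c₀≡m = toℕ-fromℕ< m<N
      others : ∀ r k → k ≢ c₀ → updated (suc m) r k ≡ updated m r k
      others r k k≢c₀ = updated-other m r k (λ k≡m → k≢c₀ (toℕ-injective (trans k≡m (sym c₀≡m))))
      same-term : ∀ r k → t c₀ k * A r k ≡ t c₀ k * updated m r k
      same-term r k with kept k in kept-k
      ... | true  = cong (t c₀ k *_) (sym (updated-kept m r k kept-k))
      ... | false = trans (cong (_* A r k) (t≡0 c₀ k kept-k))
                      (trans (*-zeroˡ (A r k)) (sym (trans (cong (_* updated m r k) (t≡0 c₀ k kept-k)) (*-zeroˡ (updated m r k)))))
      step-at : ∀ b → kept c₀ ≡ b → det N (updated (suc m)) ≡ det N (updated m)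
      step-at true kept-c₀ = det-cong N λ r k → case k F.≟ c₀ of λ where
        (yes refl) → trans (updated-new m r k c₀≡m) (trans (hkept r k kept-c₀) (sym (updated-old m r k c₀≡m)))
        (no k≢c₀)  → others r k k≢c₀
      step-at false kept-c₀ =
        det-add-column-combination N (updated m) (updated (suc m)) c₀ (t c₀) (t≡0 c₀ c₀ kept-c₀) others λ r →
          trans (updated-new m r c₀ c₀≡m)
            (trans (hchanged r c₀ kept-c₀)
                   (cong₂ _+_ (sym (updated-old m r c₀ c₀≡m)) (sumFin-cong (same-term r))))

    updated-det : ∀ m → det N (updated m) ≡ det N A
    updated-det zero    = refl
    updated-det (suc m) = trans (step m) (updated-det m)

  prodFin-punchIn : ∀ {N} (s : Fin (suc N) → ℚ) j → prodFin s ≡ s j * prodFin (λ k → s (punchIn j k))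
  prodFin-punchIn s zero = refl
  prodFin-punchIn {suc N} s (suc j) =
    trans (cong (s zero *_) (prodFin-punchIn (λ k → s (suc k)) j))
          (solve 3 (λ a b c → a :* (b :* c) := b :* (a :* c)) refl (s zero) (s (suc j)) (prodFin (λ k → s (suc (punchIn j k)))))

  det-scale-columns : ∀ N (A A′ : Mat N) (s : Fin N → ℚ) → (∀ r c → A r c ≡ s c * A′ r c) →
    det N A ≡ prodFin s * det N A′
  det-scale-columns zero    A A′ s h = refl
  det-scale-columns (suc N) A A′ s h = trans (sumFin-cong term) (sumFin-*ˡ (prodFin s) (cofactorTerm A′))
    where
    term : ∀ j → cofactorTerm A j ≡ prodFin s * cofactorTerm A′ j
    term j = begin
        σ * A zero j * det N (minor A j)
          ≡⟨ cong₂ (λ a d → σ * a * d) (h zero j) (det-scale-columns N (minor A j) (minor A′ j) sʲ (λ r k → h (suc r) (punchIn j k))) ⟩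
        σ * (s j * A′ zero j) * (prodFin sʲ * det N (minor A′ j))
          ≡⟨ solve 5 (λ σ sj a p d → σ :* (sj :* a) :* (p :* d) := (sj :* p) :* (σ :* a :* d)) refl σ (s j) (A′ zero j) (prodFin sʲ) (det N (minor A′ j)) ⟩
        (s j * prodFin sʲ) * cofactorTerm A′ j
          ≡⟨ cong (_* cofactorTerm A′ j) (sym (prodFin-punchIn s j)) ⟩
        prodFin s * cofactorTerm A′ j ∎
      where
      open ≡-Reasoning
      σ = signℚ (toℕ j)
      sʲ : Fin N → ℚ
      sʲ k = s (punchIn j k)

  UpperTriangular : ∀ {N} → Mat N → Set
  UpperTriangular A = ∀ r c → toℕ c ℕ.< toℕ r → A r c ≡ 0ℚ

  private
    det-minor-with-zero-column : ∀ {N} (A : Mat (suc N)) (j : Fin N) →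
      (∀ r → A (suc r) zero ≡ 0ℚ) → det N (minor A (suc j)) ≡ 0ℚ
    det-minor-with-zero-column {suc N} A j h = det-zero-column (suc N) (minor A (suc j)) zero h

  det-upper-triangular : ∀ N (A : Mat N) → UpperTriangular A → det N A ≡ prodFin (λ i → A i i)
  det-upper-triangular zero    A upper = refl
  det-upper-triangular (suc N) A upper = begin
      1ℚ * A zero zero * det N (minor A zero) + sumFin (λ j → cofactorTerm A (suc j))
        ≡⟨ cong₂ _+_ (cong (1ℚ * A zero zero *_) (det-upper-triangular N (minor A zero) (λ r c c<r → upper (suc r) (suc c) (ℕ.s≤s c<r))))
                     (sumFin-zero later-terms) ⟩
      1ℚ * A zero zero * P + 0ℚ
        ≡⟨ solve 2 (λ a p → con 1ℚ :* a :* p :+ con 0ℚ := a :* p) refl (A zero zero) P ⟩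
      A zero zero * P ∎
    where
    open ≡-Reasoning
    P = prodFin (λ i → A (suc i) (suc i))
    later-terms : ∀ j → cofactorTerm A (suc j) ≡ 0ℚ
    later-terms j = trans
      (cong (signℚ (toℕ (suc j)) * A zero (suc j) *_)
            (det-minor-with-zero-column A j (λ r → upper (suc r) zero (ℕ.s≤s ℕ.z≤n))))
      (*-zeroʳ (signℚ (toℕ (suc j)) * A zero (suc j)))

module Distance where

  open import Data.Nat using (zero; suc; _≤_; s≤s)
  open import Data.Bool using (Bool; true; false; _∧_; _∨_; if_then_else_)
  open import Data.Bool.Properties using (∨-zeroʳ; ∨-identityʳ)
  open import Data.Fin as F using (Fin; zero; suc)
  open import Relation.Binary.PropositionalEquality
  open import Relation.Nullary using (does)
  open import Relation.Nullary.Decidable using (dec-true; dec-false)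

  private
    anyFin-false : ∀ {M} (f : Fin M → Bool) → (∀ w → f w ≡ false) → anyFin f ≡ false
    anyFin-false {zero}  f h = refl
    anyFin-false {suc M} f h rewrite h zero = anyFin-false (λ w → f (suc w)) (λ w → h (suc w))

    anyFin-true : ∀ {M} (f : Fin M → Bool) w → f w ≡ true → anyFin f ≡ true
    anyFin-true f zero    e rewrite e = refl
    anyFin-true f (suc w) e = trans (cong (f zero ∨_) (anyFin-true (λ w → f (suc w)) w e)) (∨-zeroʳ (f zero))

    anyFin-only : ∀ {M} (u : Fin M) (g : Fin M → Bool) → anyFin (λ w → does (u F.≟ w) ∧ g w) ≡ g u
    anyFin-only {suc M} zero g = trans (cong (g zero ∨_) (anyFin-false {M} (λ w → does (zero F.≟ suc w) ∧ g (suc w)) (λ w → refl))) (∨-identityʳ (g zero))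
    anyFin-only (suc u) g = anyFin-only u (λ w → g (suc w))

    module _ {N} (adj : Fin N → Fin N → Bool) where

      reach-1 : ∀ u v → reach adj 1 u v ≡ does (u F.≟ v) ∨ adj u v
      reach-1 u v = cong (does (u F.≟ v) ∨_) (anyFin-only u (λ w → adj w v))

      reach-1-distinct : ∀ {u v} → u ≢ v → reach adj 1 u v ≡ adj u v
      reach-1-distinct {u} {v} u≢v = trans (reach-1 u v) (cong (_∨ adj u v) (dec-false (u F.≟ v) u≢v))

      walk-of-length-2 : ∀ {u v w} → adj u w ≡ true → adj w v ≡ true →
        anyFin (λ w′ → reach adj 1 u w′ ∧ adj w′ v) ≡ true
      walk-of-length-2 {u} {v} {w} uw wv = anyFin-true _ w
        (cong₂ _∧_ (trans (reach-1 u w) (trans (cong (does (u F.≟ w) ∨_) uw) (∨-zeroʳ _))) wv)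

  dist-self : ∀ {N} (adj : Fin N → Fin N → Bool) u → dist adj u u ≡ 0
  dist-self {suc N} adj u rewrite dec-true (u F.≟ u) refl = refl

  dist-adjacent : ∀ {N} → 2 ≤ N → (adj : Fin N → Fin N → Bool) {u v : Fin N} →
    u ≢ v → adj u v ≡ true → dist adj u v ≡ 1
  dist-adjacent {suc (suc n)} (s≤s (s≤s _)) adj {u} {v} u≢v uv =
    trans (cong (λ b → if b then 0 else (if reach adj 1 u v then 1 else searchDist adj u v 2 n)) (dec-false (u F.≟ v) u≢v))
          (cong (λ b → if b then 1 else searchDist adj u v 2 n) (trans (reach-1-distinct adj u≢v) uv))

  dist-common-neighbour : ∀ {N} → 3 ≤ N → (adj : Fin N → Fin N → Bool) {u v : Fin N} →
    u ≢ v → adj u v ≡ false → ∀ w → adj u w ≡ true → adj w v ≡ true → dist adj u v ≡ 2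
  dist-common-neighbour {suc (suc (suc n))} (s≤s (s≤s (s≤s _))) adj {u} {v} u≢v uv w uw wv =
    trans (cong (λ b → if b then 0 else (if reach adj 1 u v then 1 else (if reach adj 2 u v then 2 else searchDist adj u v 3 n)))
                (dec-false (u F.≟ v) u≢v))
     (trans (cong (λ b → if b then 1 else (if reach adj 2 u v then 2 else searchDist adj u v 3 n)) not-adjacent)
            (cong (λ b → if b then 2 else searchDist adj u v 3 n)
                  (trans (cong (_∨ anyFin (λ w′ → reach adj 1 u w′ ∧ adj w′ v)) not-adjacent) (walk-of-length-2 adj uw wv))))
    where
    not-adjacent : reach adj 1 u v ≡ false
    not-adjacent = trans (reach-1-distinct adj u≢v) uv

module ℕIndexed where

  open import Data.Nat as ℕ using (ℕ; zero; suc; z≤n; s≤s)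
  import Data.Nat.Properties as ℕP
  open import Data.Bool using (Bool; true; false; if_then_else_)
  open import Data.Fin using (Fin; zero; suc; toℕ)
  open import Data.Fin.Properties using (toℕ<n)
  import Data.Integer as ℤ
  import Data.Integer.Solver
  open import Data.Rational using (ℚ; 0ℚ; 1ℚ; _+_; _*_; mkℚ; toℚᵘ)
  open import Data.Rational.Properties
  import Data.Rational.Unnormalised as U
  import Data.Rational.Unnormalised.Properties as Uᴾ
  open import Function using (_∘′_)
  open import Data.Nat.Coprimality using (1-coprimeTo) renaming (sym to coprime-sym)
  open import Data.Rational.Solver using (module +-*-Solver)
  open import Relation.Binary.PropositionalEquality
  open +-*-Solver
  open Determinant

  ℕtoℚ-suc : ∀ n → ℕtoℚ (suc n) ≡ 1ℚ + ℕtoℚ n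
  ℕtoℚ-suc n = toℚᵘ-injective (Uᴾ.≃-trans unnormalised (Uᴾ.≃-sym (toℚᵘ-homo-+ 1ℚ (ℕtoℚ n))))
    where
    open Data.Integer.Solver.+-*-Solver renaming (solve to solveℤ; _:+_ to _⊕_; _:*_ to _⊗_; _:=_ to _⊜_; con to conℤ)
    normal : ∀ m → ℕtoℚ m ≡ mkℚ (ℤ.+ m) 0 (coprime-sym (1-coprimeTo m))
    normal m = normalize-coprime (coprime-sym (1-coprimeTo m))
    cross-multiplied : ∀ (z : ℤ.ℤ) → (ℤ.+ 1 ℤ.+ z) ℤ.* (ℤ.+ 1 ℤ.* ℤ.+ 1) ≡ (ℤ.+ 1 ℤ.* ℤ.+ 1 ℤ.+ z ℤ.* ℤ.+ 1) ℤ.* ℤ.+ 1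
    cross-multiplied = solveℤ 1 (λ z → (conℤ (ℤ.+ 1) ⊕ z) ⊗ (conℤ (ℤ.+ 1) ⊗ conℤ (ℤ.+ 1))
                                     ⊜ (conℤ (ℤ.+ 1) ⊗ conℤ (ℤ.+ 1) ⊕ z ⊗ conℤ (ℤ.+ 1)) ⊗ conℤ (ℤ.+ 1)) refl
    unnormalised : toℚᵘ (ℕtoℚ (suc n)) U.≃ toℚᵘ 1ℚ U.+ toℚᵘ (ℕtoℚ n)
    unnormalised rewrite normal (suc n) | normal n = U.*≡* (cross-multiplied (ℤ.+ n))

  sumℕ : ℕ → (ℕ → ℚ) → ℚ
  sumℕ zero    g = 0ℚ
  sumℕ (suc n) g = g 0 + sumℕ n (λ k → g (suc k))

  prodℕ : ℕ → (ℕ → ℚ) → ℚ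
  prodℕ zero    g = 1ℚ
  prodℕ (suc n) g = g 0 * prodℕ n (λ k → g (suc k))

  sumℕ-cong : ∀ n {g h : ℕ → ℚ} → (∀ k → k ℕ.< n → g k ≡ h k) → sumℕ n g ≡ sumℕ n h
  sumℕ-cong zero    e = refl
  sumℕ-cong (suc n) e = cong₂ _+_ (e 0 (s≤s z≤n)) (sumℕ-cong n (λ k k<n → e (suc k) (s≤s k<n)))

  prodℕ-cong : ∀ n {g h : ℕ → ℚ} → (∀ k → k ℕ.< n → g k ≡ h k) → prodℕ n g ≡ prodℕ n h
  prodℕ-cong zero    e = refl
  prodℕ-cong (suc n) e = cong₂ _*_ (e 0 (s≤s z≤n)) (prodℕ-cong n (λ k k<n → e (suc k) (s≤s k<n)))

  sumℕ-+ : ∀ a b g → sumℕ (a ℕ.+ b) g ≡ sumℕ a g + sumℕ b (λ k → g (a ℕ.+ k))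
  sumℕ-+ zero    b g = sym (+-identityˡ _)
  sumℕ-+ (suc a) b g = trans (cong (g 0 +_) (sumℕ-+ a b (λ k → g (suc k)))) (sym (+-assoc (g 0) _ _))

  prodℕ-+ : ∀ a b g → prodℕ (a ℕ.+ b) g ≡ prodℕ a g * prodℕ b (λ k → g (a ℕ.+ k))
  prodℕ-+ zero    b g = sym (*-identityˡ _)
  prodℕ-+ (suc a) b g = trans (cong (g 0 *_) (prodℕ-+ a b (λ k → g (suc k)))) (sym (*-assoc (g 0) _ _))

  sumℕ-zero : ∀ n {g : ℕ → ℚ} → (∀ k → k ℕ.< n → g k ≡ 0ℚ) → sumℕ n g ≡ 0ℚ
  sumℕ-zero zero    e = refl
  sumℕ-zero (suc n) e = cong₂ _+_ (e 0 (s≤s z≤n)) (sumℕ-zero n (λ k k<n → e (suc k) (s≤s k<n)))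

  sumℕ-single : ∀ n {g : ℕ → ℚ} a → a ℕ.< n → (∀ k → k ℕ.< n → k ≢ a → g k ≡ 0ℚ) → sumℕ n g ≡ g a
  sumℕ-single (suc n) {g} zero _ e =
    trans (cong (g 0 +_) (sumℕ-zero n (λ k k<n → e (suc k) (s≤s k<n) (λ ())))) (+-identityʳ (g 0))
  sumℕ-single (suc n) {g} (suc a) (s≤s a<n) e =
    trans (cong₂ _+_ (e 0 (s≤s z≤n) (λ ()))
                     (sumℕ-single n a a<n (λ k k<n k≢a → e (suc k) (s≤s k<n) (k≢a ∘′ ℕP.suc-injective))))
          (+-identityˡ _)

  sumℕ-const : ∀ n c → sumℕ n (λ _ → c) ≡ ℕtoℚ n * c
  sumℕ-const zero    c = sym (*-zeroˡ c)
  sumℕ-const (suc n) c = begin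
      c + sumℕ n (λ _ → c)  ≡⟨ cong (c +_) (sumℕ-const n c) ⟩
      c + ℕtoℚ n * c        ≡⟨ solve 2 (λ c q → c :+ q :* c := (con 1ℚ :+ q) :* c) refl c (ℕtoℚ n) ⟩
      (1ℚ + ℕtoℚ n) * c     ≡⟨ cong (_* c) (sym (ℕtoℚ-suc n)) ⟩
      ℕtoℚ (suc n) * c      ∎
    where open ≡-Reasoning

  prodℕ-const : ∀ n c → prodℕ n (λ _ → c) ≡ c ^ᵠ n
  prodℕ-const zero    c = refl
  prodℕ-const (suc n) c = cong (c *_) (prodℕ-const n c)

  ^ᵠ-+ : ∀ c a b → c ^ᵠ (a ℕ.+ b) ≡ c ^ᵠ a * c ^ᵠ b
  ^ᵠ-+ c zero    b = sym (*-identityˡ _)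
  ^ᵠ-+ c (suc a) b = trans (cong (c *_) (^ᵠ-+ c a b)) (sym (*-assoc c (c ^ᵠ a) (c ^ᵠ b)))

  1^ᵠn : ∀ n → 1ℚ ^ᵠ n ≡ 1ℚ
  1^ᵠn zero    = refl
  1^ᵠn (suc n) = cong (1ℚ *_) (1^ᵠn n)

  sumFin≡sumℕ : ∀ N (g : ℕ → ℚ) → sumFin {N} (λ k → g (toℕ k)) ≡ sumℕ N g
  sumFin≡sumℕ zero    g = refl
  sumFin≡sumℕ (suc N) g = cong (g 0 +_) (sumFin≡sumℕ N (λ k → g (suc k)))

  prodFin≡prodℕ : ∀ N (g : ℕ → ℚ) → prodFin {N} (λ k → g (toℕ k)) ≡ prodℕ N g
  prodFin≡prodℕ zero    g = refl
  prodFin≡prodℕ (suc N) g = cong (g 0 *_) (prodFin≡prodℕ N (λ k → g (suc k)))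

  matrix : ∀ {N} → (ℕ → ℕ → ℚ) → Mat N
  matrix E u v = E (toℕ u) (toℕ v)

  det-add-kept-column-combinationsℕ : ∀ N (E E′ : ℕ → ℕ → ℚ) (kept : ℕ → Bool) (t : ℕ → ℕ → ℚ) →
    (∀ r c → r ℕ.< N → c ℕ.< N → kept c ≡ true → E′ r c ≡ E r c) →
    (∀ r c → r ℕ.< N → c ℕ.< N → kept c ≡ false →
       E′ r c ≡ E r c + sumℕ N (λ k → (if kept k then t c k else 0ℚ) * E r k)) →
    det N (matrix E′) ≡ det N (matrix E)
  det-add-kept-column-combinationsℕ N E E′ kept t hkept hchanged =
    det-add-kept-column-combinations N (matrix E) (matrix E′) (λ c → kept (toℕ c)) masked
      (λ c k not-kept → cong (λ b → if b then t (toℕ c) (toℕ k) else 0ℚ) not-kept)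
      (λ r c → hkept (toℕ r) (toℕ c) (toℕ<n r) (toℕ<n c))
      (λ r c not-kept → trans (hchanged (toℕ r) (toℕ c) (toℕ<n r) (toℕ<n c) not-kept)
         (cong (E (toℕ r) (toℕ c) +_) (sym (sumFin≡sumℕ N (λ k → (if kept k then t (toℕ c) k else 0ℚ) * E (toℕ r) k)))))
    where
    masked : Fin N → Fin N → ℚ
    masked c k = if kept (toℕ k) then t (toℕ c) (toℕ k) else 0ℚ

  det-scale-columnsℕ : ∀ N (E E′ : ℕ → ℕ → ℚ) (s : ℕ → ℚ) → (∀ r c → E r c ≡ s c * E′ r c) →
    det N (matrix E) ≡ prodℕ N s * det N (matrix E′)
  det-scale-columnsℕ N E E′ s h =
    trans (det-scale-columns N (matrix E) (matrix E′) (λ c → s (toℕ c)) (λ r c → h (toℕ r) (toℕ c)))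
          (cong (_* det N (matrix E′)) (prodFin≡prodℕ N s))

  det-upper-triangularℕ : ∀ N (E : ℕ → ℕ → ℚ) → (∀ r c → r ℕ.< N → c ℕ.< r → E r c ≡ 0ℚ) →
    det N (matrix E) ≡ prodℕ N (λ i → E i i)
  det-upper-triangularℕ N E upper =
    trans (det-upper-triangular N (matrix E) (λ r c c<r → upper (toℕ r) (toℕ c) (toℕ<n r) c<r))
          (prodFin≡prodℕ N (λ i → E i i))

module Blocks where

  open import Data.Nat as ℕ using (ℕ; zero; suc; _∸_; _<ᵇ_; _≡ᵇ_; z≤n; s≤s)
  import Data.Nat.Properties as ℕP
  open import Data.Bool using (Bool; true; false; if_then_else_)
  open import Data.List using (List; []; _∷_; length)
  open import Data.Nat.ListAction using (sum)
  open import Data.List.Relation.Unary.All using (All; []; _∷_)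
  open import Data.Rational using (ℚ; 0ℚ; 1ℚ; _+_; _*_)
  open import Data.Rational.Properties using (+-identityˡ; +-identityʳ)
  open import Relation.Binary.PropositionalEquality
  open import Relation.Nullary using (yes; no)
  open import Relation.Nullary.Decidable using (dec-true; dec-false)
  open ℕIndexed

  -- Vertex j (counted from 0, the dominating vertex excluded) lies in block
  -- number `block ns j`; `leader ns j` is the first vertex of that block.
  isLeader : List ℕ → ℕ → Bool
  isLeader []       j = false
  isLeader (m ∷ ms) j = if j <ᵇ m then j ≡ᵇ 0 else isLeader ms (j ∸ m)

  leader : List ℕ → ℕ → ℕ
  leader []       j = j
  leader (m ∷ ms) j = if j <ᵇ m then 0 else m ℕ.+ leader ms (j ∸ m)

  blockSize : List ℕ → ℕ → ℕ
  blockSize []       l       = 0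
  blockSize (m ∷ ms) zero    = m
  blockSize (m ∷ ms) (suc l) = blockSize ms l

  private
    <ᵇ-true : ∀ {j m} → j ℕ.< m → (j <ᵇ m) ≡ true
    <ᵇ-true {j} {m} j<m = dec-true (j ℕ.<? m) j<m

    <ᵇ-false : ∀ m k → ((m ℕ.+ k) <ᵇ m) ≡ false
    <ᵇ-false m k = dec-false ((m ℕ.+ k) ℕ.<? m) (ℕP.m+n≮m m k)

  module _ {m : ℕ} {ms : List ℕ} where

    block-< : ∀ {j} → j ℕ.< m → block (m ∷ ms) j ≡ 0
    block-< j<m rewrite <ᵇ-true j<m = refl

    block-+ : ∀ k → block (m ∷ ms) (m ℕ.+ k) ≡ suc (block ms k)
    block-+ k rewrite <ᵇ-false m k | ℕP.m+n∸m≡n m k = refl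

    isLeader-< : ∀ {j} → j ℕ.< m → isLeader (m ∷ ms) j ≡ (j ≡ᵇ 0)
    isLeader-< j<m rewrite <ᵇ-true j<m = refl

    isLeader-+ : ∀ k → isLeader (m ∷ ms) (m ℕ.+ k) ≡ isLeader ms k
    isLeader-+ k rewrite <ᵇ-false m k | ℕP.m+n∸m≡n m k = refl

    leader-< : ∀ {j} → j ℕ.< m → leader (m ∷ ms) j ≡ 0
    leader-< j<m rewrite <ᵇ-true j<m = refl

    leader-+ : ∀ k → leader (m ∷ ms) (m ℕ.+ k) ≡ m ℕ.+ leader ms k
    leader-+ k rewrite <ᵇ-false m k | ℕP.m+n∸m≡n m k = refl

  data Split (m s j : ℕ) : Set where
    below : j ℕ.< m → Split m s j
    above : ∀ k → j ≡ m ℕ.+ k → k ℕ.< s → Split m s j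

  split : ∀ m s j → j ℕ.< m ℕ.+ s → Split m s j
  split m s j j<m+s with j ℕ.<? m
  ... | yes j<m = below j<m
  ... | no j≮m  = above (j ∸ m) (sym m+[j∸m]≡j) (ℕP.+-cancelˡ-< m (j ∸ m) s (subst (ℕ._< m ℕ.+ s) (sym m+[j∸m]≡j) j<m+s))
    where
    m+[j∸m]≡j : m ℕ.+ (j ∸ m) ≡ j
    m+[j∸m]≡j = ℕP.m+[n∸m]≡n (ℕP.≮⇒≥ j≮m)

  private
    0<m : ∀ {j m} → j ℕ.< m → 0 ℕ.< m
    0<m j<m = ℕP.≤-trans (s≤s z≤n) j<m

  isLeader-leader : ∀ ns j → j ℕ.< sum ns → isLeader ns (leader ns j) ≡ true
  isLeader-leader (m ∷ ms) j j< with split m (sum ms) j j<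
  ... | below j<m rewrite leader-< {m} {ms} j<m | isLeader-< {m} {ms} (0<m j<m) = refl
  ... | above k refl k< rewrite leader-+ {m} {ms} k | isLeader-+ {m} {ms} (leader ms k) = isLeader-leader ms k k<

  block-leader : ∀ ns j → j ℕ.< sum ns → block ns (leader ns j) ≡ block ns j
  block-leader (m ∷ ms) j j< with split m (sum ms) j j<
  ... | below j<m rewrite leader-< {m} {ms} j<m | block-< {m} {ms} (0<m j<m) | block-< {m} {ms} j<m = refl
  ... | above k refl k< rewrite leader-+ {m} {ms} k | block-+ {m} {ms} (leader ms k) | block-+ {m} {ms} k =
    cong suc (block-leader ms k k<)

  leader-≤ : ∀ ns j → j ℕ.< sum ns → leader ns j ℕ.≤ j
  leader-≤ (m ∷ ms) j j< with split m (sum ms) j j<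
  ... | below j<m rewrite leader-< {m} {ms} j<m = z≤n
  ... | above k refl k< rewrite leader-+ {m} {ms} k = ℕP.+-monoʳ-≤ m (leader-≤ ms k k<)

  private
    leader-isLeader-< : ∀ m ms j → j ℕ.< m → isLeader (m ∷ ms) j ≡ true → leader (m ∷ ms) j ≡ j
    leader-isLeader-< m ms zero    j<m _    = leader-< {m} {ms} j<m
    leader-isLeader-< m ms (suc j) j<m lead with trans (sym (isLeader-< {m} {ms} j<m)) lead
    ... | ()

  leader-isLeader : ∀ ns j → j ℕ.< sum ns → isLeader ns j ≡ true → leader ns j ≡ j
  leader-isLeader (m ∷ ms) j j< lead with split m (sum ms) j j<
  ... | below j<m = leader-isLeader-< m ms j j<m lead
  ... | above k refl k< rewrite leader-+ {m} {ms} k | isLeader-+ {m} {ms} k =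
    cong (m ℕ.+_) (leader-isLeader ms k k< lead)

  leader-unique : ∀ ns j i → j ℕ.< sum ns → i ℕ.< sum ns → isLeader ns i ≡ true →
    block ns i ≡ block ns j → leader ns j ≡ i
  leader-unique (m ∷ ms) j i j< i< lead same with split m (sum ms) j j< | split m (sum ms) i i<
  ... | below j<m | below i<m = trans (leader-< {m} {ms} j<m) (sym (trans (sym (leader-isLeader (m ∷ ms) i i< lead)) (leader-< {m} {ms} i<m)))
  ... | below j<m | above k refl _ with trans (sym (block-+ {m} {ms} k)) (trans same (block-< {m} {ms} j<m))
  ...   | ()
  leader-unique (m ∷ ms) j i j< i< lead same | above k refl _ | below i<m
    with trans (sym (block-< {m} {ms} i<m)) (trans same (block-+ {m} {ms} k))
  ... | ()
  leader-unique (m ∷ ms) j i j< i< lead same | above k refl k< | above k′ refl k′< rewrite leader-+ {m} {ms} k =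
    cong (m ℕ.+_) (leader-unique ms k k′ k< k′< (trans (sym (isLeader-+ {m} {ms} k′)) lead)
                     (ℕP.suc-injective (trans (sym (block-+ {m} {ms} k′)) (trans same (block-+ {m} {ms} k)))))

  All-blockSize : ∀ {P : ℕ → Set} ns → All P ns → ∀ j → j ℕ.< sum ns → P (blockSize ns (block ns j))
  All-blockSize (m ∷ ms) (p ∷ ps) j j< with split m (sum ms) j j<
  ... | below j<m rewrite block-< {m} {ms} j<m = p
  ... | above k refl k< rewrite block-+ {m} {ms} k = All-blockSize ms ps k k<

  block<length : ∀ ns j → j ℕ.< sum ns → block ns j ℕ.< length ns
  block<length (m ∷ ms) j j< with split m (sum ms) j j<
  ... | below j<m rewrite block-< {m} {ms} j<m = s≤s z≤n
  ... | above k refl k< rewrite block-+ {m} {ms} k = s≤s (block<length ms k k<)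

  -- A summand depending only on (isLeader, block) is summed block by block:
  -- each block of size m contributes one leader term and m - 1 others.
  blockSum : List ℕ → (Bool → ℕ → ℚ) → ℚ
  blockSum []       F = 0ℚ
  blockSum (m ∷ ms) F = F true 0 + sumℕ (m ∸ 1) (λ _ → F false 0) + blockSum ms (λ b l → F b (suc l))

  blockProd : List ℕ → (Bool → ℕ → ℚ) → ℚ
  blockProd []       F = 1ℚ
  blockProd (m ∷ ms) F = F true 0 * prodℕ (m ∸ 1) (λ _ → F false 0) * blockProd ms (λ b l → F b (suc l))

  sumℕ-by-blocks : ∀ ns → All (1 ℕ.≤_) ns → ∀ F →
    sumℕ (sum ns) (λ j → F (isLeader ns j) (block ns j)) ≡ blockSum ns F
  sumℕ-by-blocks []            _        F = refl
  sumℕ-by-blocks (suc m ∷ ms) (_ ∷ ps) F = begin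
      sumℕ (suc m ℕ.+ sum ms) G
        ≡⟨ sumℕ-+ (suc m) (sum ms) G ⟩
      sumℕ (suc m) G + sumℕ (sum ms) (λ k → G (suc m ℕ.+ k))
        ≡⟨ cong₂ _+_ (sumℕ-cong (suc m) (λ j j< → cong₂ F (isLeader-< {suc m} {ms} j<) (block-< {suc m} {ms} j<)))
                     (trans (sumℕ-cong (sum ms) (λ k _ → cong₂ F (isLeader-+ {suc m} {ms} k) (block-+ {suc m} {ms} k)))
                            (sumℕ-by-blocks ms ps (λ b l → F b (suc l)))) ⟩
      (F true 0 + sumℕ m (λ _ → F false 0)) + blockSum ms (λ b l → F b (suc l)) ∎
    where
    open ≡-Reasoning
    G : ℕ → ℚ
    G j = F (isLeader (suc m ∷ ms) j) (block (suc m ∷ ms) j)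

  prodℕ-by-blocks : ∀ ns → All (1 ℕ.≤_) ns → ∀ F →
    prodℕ (sum ns) (λ j → F (isLeader ns j) (block ns j)) ≡ blockProd ns F
  prodℕ-by-blocks []            _        F = refl
  prodℕ-by-blocks (suc m ∷ ms) (_ ∷ ps) F = begin
      prodℕ (suc m ℕ.+ sum ms) G
        ≡⟨ prodℕ-+ (suc m) (sum ms) G ⟩
      prodℕ (suc m) G * prodℕ (sum ms) (λ k → G (suc m ℕ.+ k))
        ≡⟨ cong₂ _*_ (prodℕ-cong (suc m) (λ j j< → cong₂ F (isLeader-< {suc m} {ms} j<) (block-< {suc m} {ms} j<)))
                     (trans (prodℕ-cong (sum ms) (λ k _ → cong₂ F (isLeader-+ {suc m} {ms} k) (block-+ {suc m} {ms} k)))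
                            (prodℕ-by-blocks ms ps (λ b l → F b (suc l)))) ⟩
      (F true 0 * prodℕ m (λ _ → F false 0)) * blockProd ms (λ b l → F b (suc l)) ∎
    where
    open ≡-Reasoning
    G : ℕ → ℚ
    G j = F (isLeader (suc m ∷ ms) j) (block (suc m ∷ ms) j)

  private
    blockSum-zero : ∀ ns F → (∀ b l → F b l ≡ 0ℚ) → blockSum ns F ≡ 0ℚ
    blockSum-zero []       F F≡0 = refl
    blockSum-zero (m ∷ ms) F F≡0 =
      cong₂ _+_ (cong₂ _+_ (F≡0 true 0) (sumℕ-zero (m ∸ 1) (λ _ _ → F≡0 false 0)))
                (blockSum-zero ms (λ b l → F b (suc l)) (λ b l → F≡0 b (suc l)))

  blockSum-non-leaders-of : ∀ ns L c → L ℕ.< length ns →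
    blockSum ns (λ b l → if b then 0ℚ else (if l ≡ᵇ L then c else 0ℚ)) ≡ sumℕ (blockSize ns L ∸ 1) (λ _ → c)
  blockSum-non-leaders-of (m ∷ ms) zero c _ =
    trans (cong (λ v → 0ℚ + sumℕ (m ∸ 1) (λ _ → c) + v) (blockSum-zero ms _ (λ { true _ → refl ; false _ → refl })))
          (trans (+-identityʳ _) (+-identityˡ _))
  blockSum-non-leaders-of (m ∷ ms) (suc L) c (s≤s L<) =
    trans (cong₂ (λ u v → 0ℚ + u + v) (sumℕ-zero (m ∸ 1) (λ _ _ → refl)) (blockSum-non-leaders-of ms L c L<))
          (+-identityˡ _)

open import Data.Nat as ℕ using (ℕ; zero; suc; _≤_; _∸_; _≡ᵇ_; z≤n; s≤s)
import Data.Nat.Properties as ℕP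
open import Data.Bool using (Bool; true; false; if_then_else_; not; _∧_)
open import Data.Bool.Properties using (not-involutive)
open import Data.List using (List; []; _∷_; length)
open import Data.Nat.ListAction using (sum)
open import Data.List.Relation.Unary.All using (All; []; _∷_)
open import Data.Fin as F using (Fin; zero; suc; toℕ)
open import Data.Fin.Properties using (toℕ-injective; suc-injective)
open import Data.Rational using (ℚ; 0ℚ; 1ℚ; _+_; _*_; _-_; -_; 1/_; ≢-nonZero)
open import Data.Rational.Properties
  using (*-identityˡ; *-identityʳ; *-zeroˡ; *-zeroʳ; +-identityʳ; *-assoc; *-inverseˡ)
  renaming (_≟_ to _≟ℚ_)
open import Data.Rational.Solver using (module +-*-Solver)
open import Data.Empty using (⊥-elim)
open import Function using (_∘_)
open import Relation.Binary.PropositionalEquality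
open import Relation.Nullary using (Dec; yes; no; does)
open import Relation.Nullary.Decidable using (dec-true; dec-false)
open +-*-Solver
open Determinant
open Distance
open ℕIndexed
open Blocks

≡⇒≡ᵇ-true : ∀ {i j} → i ≡ j → (i ≡ᵇ j) ≡ true
≡⇒≡ᵇ-true {i} {j} i≡j = dec-true (i ℕ.≟ j) i≡j

≡ᵇ-refl : ∀ i → (i ≡ᵇ i) ≡ true
≡ᵇ-refl i = ≡⇒≡ᵇ-true {i} refl

≢⇒≡ᵇ-false : ∀ {i j} → i ≢ j → (i ≡ᵇ j) ≡ false
≢⇒≡ᵇ-false {i} {j} i≢j = dec-false (i ℕ.≟ j) i≢j

does-≟-toℕ : ∀ {N} (u v : Fin N) → does (u F.≟ v) ≡ (toℕ u ≡ᵇ toℕ v)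
does-≟-toℕ u v with u F.≟ v
... | yes refl = sym (≡ᵇ-refl (toℕ u))
... | no u≢v   = sym (≢⇒≡ᵇ-false (u≢v ∘ toℕ-injective))

distK : List ℕ → ℕ → ℕ → ℕ
distK ns zero    zero    = 0
distK ns zero    (suc j) = 1
distK ns (suc i) zero    = 1
distK ns (suc i) (suc j) = if i ≡ᵇ j then 0 else (if block ns i ≡ᵇ block ns j then 1 else 2)

dist-adjK : ∀ ns → 3 ℕ.≤ suc (sum ns) → ∀ u v → dist (adjK ns) u v ≡ distK ns (toℕ u) (toℕ v)
dist-adjK ns 3≤n = distances
  where
  2≤n : 2 ℕ.≤ suc (sum ns)
  2≤n = ℕP.≤-trans (ℕP.n≤1+n 2) 3≤n
  distances : ∀ u v → dist (adjK ns) u v ≡ distK ns (toℕ u) (toℕ v)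
  distances zero    zero    = dist-self (adjK ns) zero
  distances zero    (suc j) = dist-adjacent 2≤n (adjK ns) {zero} {suc j} (λ ()) refl
  distances (suc i) zero    = dist-adjacent 2≤n (adjK ns) {suc i} {zero} (λ ()) refl
  distances (suc i) (suc j) = same-clique (i F.≟ j)
    where
    bi = block ns (toℕ i)
    bj = block ns (toℕ j)
    same-clique : Dec (i ≡ j) → dist (adjK ns) (suc i) (suc j) ≡ distK ns (suc (toℕ i)) (suc (toℕ j))
    same-clique (yes refl) rewrite ≡ᵇ-refl (toℕ i) = dist-self (adjK ns) (suc i)
    same-clique (no i≢j) rewrite ≢⇒≡ᵇ-false (i≢j ∘ toℕ-injective) = off-diagonal (bi ℕ.≟ bj)
      where
      adjK-blocks : adjK ns (suc i) (suc j) ≡ (bi ≡ᵇ bj)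
      adjK-blocks = cong (λ b → not b ∧ (bi ≡ᵇ bj)) (dec-false (i F.≟ j) i≢j)
      off-diagonal : Dec (bi ≡ bj) → dist (adjK ns) (suc i) (suc j) ≡ (if bi ≡ᵇ bj then 1 else 2)
      off-diagonal (yes same) rewrite ≡⇒≡ᵇ-true same =
        dist-adjacent 2≤n (adjK ns) (i≢j ∘ suc-injective) (trans adjK-blocks (≡⇒≡ᵇ-true same))
      off-diagonal (no different) rewrite ≢⇒≡ᵇ-false different =
        dist-common-neighbour 3≤n (adjK ns) (i≢j ∘ suc-injective) (trans adjK-blocks (≢⇒≡ᵇ-false different)) zero refl refl

charMatrix : List ℕ → ℚ → ℕ → ℕ → ℚ
charMatrix ns x r c = (if r ≡ᵇ c then x else 0ℚ) - ℕtoℚ (distK ns r c)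

charPolyD≡det-charMatrix : ∀ ns x → 3 ℕ.≤ suc (sum ns) →
  charPolyD ns x ≡ det (suc (sum ns)) (matrix (charMatrix ns x))
charPolyD≡det-charMatrix ns x 3≤n = det-cong (suc (sum ns)) λ u v →
  cong₂ (λ b d → (if b then x else 0ℚ) - ℕtoℚ d) (does-≟-toℕ u v) (dist-adjK ns 3≤n u v)

module Reduction (ns : List ℕ) (x : ℚ) (ns≥1 : All (1 ℕ.≤_) ns) where

  n′ : ℕ
  n′ = sum ns
  blk : ℕ → ℕ
  blk = block ns
  lead : ℕ → Bool
  lead = isLeader ns
  ldr : ℕ → ℕ
  ldr = leader ns
  two : ℚ
  two = ℕtoℚ 2
  μ : ℚ
  μ = x + 1ℚ
  size : ℕ → ℚ
  size l = ℕtoℚ (blockSize ns l)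
  pole : ℕ → ℚ
  pole l = x + size l + 1ℚ

  M₀ : ℕ → ℕ → ℚ
  M₀ = charMatrix ns x

  -- M₀ after subtracting twice column 0 from every other column
  M₁ : ℕ → ℕ → ℚ
  M₁ r       zero    = M₀ r zero
  M₁ zero    (suc j) = - (two * x + 1ℚ)
  M₁ (suc i) (suc j) = if i ≡ᵇ j then x + two else (if blk i ≡ᵇ blk j then 1ℚ else 0ℚ)

  private
    sumℕ-0* : ∀ n (g : ℕ → ℚ) → sumℕ n (λ k → 0ℚ * g k) ≡ 0ℚ
    sumℕ-0* n g = sumℕ-zero n (λ k _ → *-zeroˡ (g k))

  det-M₁ : det (suc n′) (matrix M₁) ≡ det (suc n′) (matrix M₀)
  det-M₁ = det-add-kept-column-combinationsℕ (suc n′) M₀ M₁ (_≡ᵇ 0) (λ _ _ → - two) kept changed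
    where
    kept : ∀ r c → r ℕ.< suc n′ → c ℕ.< suc n′ → (c ≡ᵇ 0) ≡ true → M₁ r c ≡ M₀ r c
    kept r zero _ _ _ = refl
    changed : ∀ r c → r ℕ.< suc n′ → c ℕ.< suc n′ → (c ≡ᵇ 0) ≡ false →
      M₁ r c ≡ M₀ r c + sumℕ (suc n′) (λ k → (if k ≡ᵇ 0 then - two else 0ℚ) * M₀ r k)
    changed zero (suc j) _ _ _ rewrite sumℕ-0* n′ (λ k → M₀ 0 (suc k)) =
      solve 1 (λ x → :- (con two :* x :+ con 1ℚ) := (con 0ℚ :- con (ℕtoℚ 1)) :+ (:- con two :* (x :- con (ℕtoℚ 0)) :+ con 0ℚ)) refl x
    changed (suc i) (suc j) _ _ _ rewrite sumℕ-0* n′ (λ k → M₀ (suc i) (suc k)) with i ℕ.≟ j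
    ... | yes refl rewrite ≡ᵇ-refl i =
      solve 1 (λ x → x :+ con two := (x :- con (ℕtoℚ 0)) :+ (:- con two :* (con 0ℚ :- con (ℕtoℚ 1)) :+ con 0ℚ)) refl x
    ... | no i≢j rewrite ≢⇒≡ᵇ-false i≢j with blk i ℕ.≟ blk j
    ...   | yes same rewrite same | ≡ᵇ-refl (blk j) =
      solve 0 (con 1ℚ := (con 0ℚ :- con (ℕtoℚ 1)) :+ (:- con two :* (con 0ℚ :- con (ℕtoℚ 1)) :+ con 0ℚ)) refl
    ...   | no different rewrite ≢⇒≡ᵇ-false different =
      solve 0 (con 0ℚ := (con 0ℚ :- con (ℕtoℚ 2)) :+ (:- con two :* (con 0ℚ :- con (ℕtoℚ 1)) :+ con 0ℚ)) refl

  ldr-isLeader : ∀ j → j ℕ.< n′ → lead (ldr j) ≡ true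
  ldr-isLeader j j< = isLeader-leader ns j j<

  blk-ldr : ∀ j → j ℕ.< n′ → blk (ldr j) ≡ blk j
  blk-ldr j j< = block-leader ns j j<

  ldr< : ∀ j → j ℕ.< n′ → ldr j ℕ.< n′
  ldr< j j< = ℕP.≤-<-trans (leader-≤ ns j j<) j<

  leader≢non-leader : ∀ {i j} → lead i ≡ true → lead j ≡ false → i ≢ j
  leader≢non-leader li lj refl with trans (sym li) lj
  ... | ()

  ldr≢non-leader : ∀ i k → k ℕ.< n′ → lead i ≡ false → ldr k ≢ i
  ldr≢non-leader i k k< li = leader≢non-leader (ldr-isLeader k k<) li

  nonLeaderColumn : ℕ → ℕ → ℚ
  nonLeaderColumn zero    j = 0ℚ
  nonLeaderColumn (suc i) j = if i ≡ᵇ j then 1ℚ else (if i ≡ᵇ ldr j then - 1ℚ else 0ℚ)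

  -- Subtracting from each non-leader column the column of its leader leaves
  -- μ (e_j − e_{leader j}); M₂ is the result with these factors μ taken out.
  M₂ : ℕ → ℕ → ℚ
  M₂ r zero    = M₁ r zero
  M₂ r (suc j) = if lead j then M₁ r (suc j) else nonLeaderColumn r j

  scale : ℕ → ℚ
  scale zero    = 1ℚ
  scale (suc j) = if lead j then 1ℚ else μ

  private
    column0OrLeader : ℕ → Bool
    column0OrLeader zero    = true
    column0OrLeader (suc j) = lead j

    minusLeader : ℕ → ℕ → ℚ
    minusLeader (suc j) (suc k) = if k ≡ᵇ ldr j then - 1ℚ else 0ℚ
    minusLeader _       _       = 0ℚ

    scaled-non-leader : ∀ r j → r ℕ.< suc n′ → j ℕ.< n′ → lead j ≡ false →
      μ * nonLeaderColumn r j ≡ M₁ r (suc j) + (0ℚ * M₁ r 0 + - 1ℚ * M₁ r (suc (ldr j)))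
    scaled-non-leader zero j _ j< lj =
      solve 2 (λ x a → (x :+ con 1ℚ) :* con 0ℚ := :- (con two :* x :+ con 1ℚ) :+ (con 0ℚ :* a :+ :- con 1ℚ :* (:- (con two :* x :+ con 1ℚ)))) refl x (M₁ 0 0)
    scaled-non-leader (suc i) j _ j< lj with i ℕ.≟ j
    ... | yes refl rewrite ≡ᵇ-refl i | ≢⇒≡ᵇ-false (ldr≢non-leader i i j< lj ∘ sym) | blk-ldr i j< | ≡ᵇ-refl (blk i) =
      solve 2 (λ x a → (x :+ con 1ℚ) :* con 1ℚ := (x :+ con two) :+ (con 0ℚ :* a :+ :- con 1ℚ :* con 1ℚ)) refl x (M₁ (suc i) 0)
    ... | no i≢j rewrite ≢⇒≡ᵇ-false i≢j with i ℕ.≟ ldr j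
    ...   | yes refl rewrite ≡ᵇ-refl (ldr j) | blk-ldr j j< | ≡ᵇ-refl (blk j) =
      solve 2 (λ x a → (x :+ con 1ℚ) :* (:- con 1ℚ) := con 1ℚ :+ (con 0ℚ :* a :+ :- con 1ℚ :* (x :+ con two))) refl x (M₁ (suc (ldr j)) 0)
    ...   | no i≢ldr rewrite ≢⇒≡ᵇ-false i≢ldr | blk-ldr j j< =
      solve 3 (λ x a v → (x :+ con 1ℚ) :* con 0ℚ := v :+ (con 0ℚ :* a :+ :- con 1ℚ :* v)) refl x (M₁ (suc i) 0) (if blk i ≡ᵇ blk j then 1ℚ else 0ℚ)

  det-M₁≡scale*det-M₂ : det (suc n′) (matrix M₁) ≡ prodℕ (suc n′) scale * det (suc n′) (matrix M₂)
  det-M₁≡scale*det-M₂ =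
    trans (sym (det-add-kept-column-combinationsℕ (suc n′) M₁ (λ r c → scale c * M₂ r c) column0OrLeader minusLeader kept changed))
          (det-scale-columnsℕ (suc n′) (λ r c → scale c * M₂ r c) M₂ scale (λ r c → refl))
    where
    kept : ∀ r c → r ℕ.< suc n′ → c ℕ.< suc n′ → column0OrLeader c ≡ true → scale c * M₂ r c ≡ M₁ r c
    kept r zero    _ _ _  = *-identityˡ _
    kept r (suc j) _ _ lj rewrite lj = *-identityˡ _
    changed : ∀ r c → r ℕ.< suc n′ → c ℕ.< suc n′ → column0OrLeader c ≡ false →
      scale c * M₂ r c ≡ M₁ r c + sumℕ (suc n′) (λ k → (if column0OrLeader k then minusLeader c k else 0ℚ) * M₁ r k)
    changed r (suc j) r< (s≤s j<) lj = begin
        scale (suc j) * M₂ r (suc j)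
          ≡⟨ cong₂ _*_ (cong (λ b → if b then 1ℚ else μ) lj) (cong (λ b → if b then M₁ r (suc j) else nonLeaderColumn r j) lj) ⟩
        μ * nonLeaderColumn r j
          ≡⟨ scaled-non-leader r j r< j< lj ⟩
        M₁ r (suc j) + (0ℚ * M₁ r 0 + - 1ℚ * M₁ r (suc (ldr j)))
          ≡⟨ cong (λ z → M₁ r (suc j) + (0ℚ * M₁ r 0 + z)) (sym only-leader) ⟩
        M₁ r (suc j) + (0ℚ * M₁ r 0 + sumℕ n′ g) ∎
      where
      open ≡-Reasoning
      g : ℕ → ℚ
      g k = (if lead k then (if k ≡ᵇ ldr j then - 1ℚ else 0ℚ) else 0ℚ) * M₁ r (suc k)
      others : ∀ k → k ℕ.< n′ → k ≢ ldr j → g k ≡ 0ℚ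
      others k _ k≢ rewrite ≢⇒≡ᵇ-false k≢ with lead k
      ... | true  = *-zeroˡ (M₁ r (suc k))
      ... | false = *-zeroˡ (M₁ r (suc k))
      only-leader : sumℕ n′ g ≡ - 1ℚ * M₁ r (suc (ldr j))
      only-leader = trans (sumℕ-single n′ (ldr j) (ldr< j j<) others)
        (cong₂ (λ b c → (if b then (if c then - 1ℚ else 0ℚ) else 0ℚ) * M₁ r (suc (ldr j))) (ldr-isLeader j j<) (≡ᵇ-refl (ldr j)))

  leader-of-block : ∀ i k → i ℕ.< n′ → k ℕ.< n′ → lead i ≡ true → blk k ≡ blk i → ldr k ≡ i
  leader-of-block i k i< k< li same = leader-unique ns k i k< i< li (sym same)

  ldr≢other-block : ∀ i k → k ℕ.< n′ → blk k ≢ blk i → ldr k ≢ i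
  ldr≢other-block i k k< different ldr≡i = different (trans (sym (blk-ldr k k<)) (cong blk ldr≡i))

  leaders-in-different-blocks : ∀ i j → i ℕ.< n′ → j ℕ.< n′ → lead i ≡ true → lead j ≡ true → i ≢ j → blk i ≢ blk j
  leaders-in-different-blocks i j i< j< li lj i≢j same =
    i≢j (trans (sym (leader-of-block i j i< j< li (sym same))) (leader-isLeader ns j j< lj))

  blockSize≡1+ : ∀ i → i ℕ.< n′ → size (blk i) ≡ 1ℚ + ℕtoℚ (blockSize ns (blk i) ∸ 1)
  blockSize≡1+ i i< with blockSize ns (blk i) | All-blockSize ns ns≥1 i i<
  ... | suc s | _ = ℕtoℚ-suc s

  -- What row r of column c gains when the non-leader columns of M₂, which are
  -- e_j − e_{leader j}, are used to clear column c in the non-leader rows.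
  elimination : ℕ → ℕ → ℚ
  elimination c r = sumℕ n′ (λ k → (if not (lead k) then - M₂ (suc k) c else 0ℚ) * M₂ r (suc k))

  elimination-row0 : ∀ c → elimination c 0 ≡ 0ℚ
  elimination-row0 c = sumℕ-zero n′ vanishes
    where
    vanishes : ∀ k → k ℕ.< n′ → (if not (lead k) then - M₂ (suc k) c else 0ℚ) * M₂ 0 (suc k) ≡ 0ℚ
    vanishes k _ with lead k
    ... | true  = *-zeroˡ (M₁ 0 (suc k))
    ... | false = *-zeroʳ (- M₂ (suc k) c)

  elimination-non-leader : ∀ c i → i ℕ.< n′ → lead i ≡ false → elimination c (suc i) ≡ - M₂ (suc i) c * 1ℚ
  elimination-non-leader c i i< li = trans (sumℕ-single n′ i i< others) at-i
    where
    others : ∀ k → k ℕ.< n′ → k ≢ i → (if not (lead k) then - M₂ (suc k) c else 0ℚ) * M₂ (suc i) (suc k) ≡ 0ℚ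
    others k k< k≢i with lead k in lk
    ... | true  = *-zeroˡ (M₁ (suc i) (suc k))
    ... | false rewrite ≢⇒≡ᵇ-false (k≢i ∘ sym) | ≢⇒≡ᵇ-false (ldr≢non-leader i k k< li ∘ sym) = *-zeroʳ (- M₂ (suc k) c)
    at-i : (if not (lead i) then - M₂ (suc i) c else 0ℚ) * M₂ (suc i) (suc i) ≡ - M₂ (suc i) c * 1ℚ
    at-i rewrite li | ≡ᵇ-refl i = refl

  elimination-leader : ∀ c i → i ℕ.< n′ → lead i ≡ true → ∀ v →
    (∀ k → lead k ≡ false → blk k ≡ blk i → - M₂ (suc k) c * - 1ℚ ≡ v) →
    elimination c (suc i) ≡ ℕtoℚ (blockSize ns (blk i) ∸ 1) * v
  elimination-leader c i i< li v block-entry = begin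
      elimination c (suc i)
        ≡⟨ sumℕ-cong n′ (λ k k< → entry k k<) ⟩
      sumℕ n′ (λ k → F (lead k) (blk k))
        ≡⟨ sumℕ-by-blocks ns ns≥1 F ⟩
      blockSum ns F
        ≡⟨ blockSum-non-leaders-of ns (blk i) v (block<length ns i i<) ⟩
      sumℕ (blockSize ns (blk i) ∸ 1) (λ _ → v)
        ≡⟨ sumℕ-const (blockSize ns (blk i) ∸ 1) v ⟩
      ℕtoℚ (blockSize ns (blk i) ∸ 1) * v ∎
    where
    open ≡-Reasoning
    F : Bool → ℕ → ℚ
    F b l = if b then 0ℚ else (if l ≡ᵇ blk i then v else 0ℚ)
    entry : ∀ k → k ℕ.< n′ → (if not (lead k) then - M₂ (suc k) c else 0ℚ) * M₂ (suc i) (suc k) ≡ F (lead k) (blk k)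
    entry k k< with lead k in lk
    ... | true = *-zeroˡ (M₁ (suc i) (suc k))
    ... | false with blk k ℕ.≟ blk i
    ...   | yes same rewrite ≢⇒≡ᵇ-false (leader≢non-leader li lk) | leader-of-block i k i< k< li same | ≡ᵇ-refl i
                           | same | ≡ᵇ-refl (blk i) = block-entry k lk same
    ...   | no different rewrite ≢⇒≡ᵇ-false (leader≢non-leader li lk) | ≢⇒≡ᵇ-false (ldr≢other-block i k k< different ∘ sym)
                               | ≢⇒≡ᵇ-false different = *-zeroʳ (- M₂ (suc k) c)

  -- Clearing, by the non-leader columns, the non-leader rows of column 0 and
  -- of the leader columns.
  M₃ : ℕ → ℕ → ℚ
  M₃ zero    zero    = x - ℕtoℚ 0
  M₃ (suc i) zero    = if lead i then - size (blk i) else 0ℚ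
  M₃ zero    (suc j) = if lead j then - (two * x + 1ℚ) else nonLeaderColumn 0 j
  M₃ (suc i) (suc j) = if lead j then (if i ≡ᵇ j then pole (blk j) else 0ℚ) else nonLeaderColumn (suc i) j

  private
    isNonLeaderColumn : ℕ → Bool
    isNonLeaderColumn zero    = false
    isNonLeaderColumn (suc k) = not (lead k)

    eliminated : ℕ → ℕ → ℚ
    eliminated c k = - M₂ k c

    EliminationStep : ℕ → ℕ → Set
    EliminationStep r c = M₃ r c ≡ M₂ r c + (0ℚ * M₂ r 0 + elimination c r)

    column0-eliminated : ∀ r → r ℕ.< suc n′ → EliminationStep r 0
    column0-eliminated zero _ = trans (solve 1 (λ a → a := a :+ (con 0ℚ :* a :+ con 0ℚ)) refl (x - ℕtoℚ 0))
      (cong (λ z → M₂ 0 0 + (0ℚ * M₂ 0 0 + z)) (sym (elimination-row0 0)))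
    column0-eliminated (suc i) (s≤s i<) with lead i in li
    ... | false = begin
        0ℚ
          ≡⟨ solve 0 (con 0ℚ := (con 0ℚ :- con (ℕtoℚ 1)) :+ (con 0ℚ :* (con 0ℚ :- con (ℕtoℚ 1)) :+ :- (con 0ℚ :- con (ℕtoℚ 1)) :* con 1ℚ)) refl ⟩
        (0ℚ - ℕtoℚ 1) + (0ℚ * (0ℚ - ℕtoℚ 1) + - (0ℚ - ℕtoℚ 1) * 1ℚ)
          ≡⟨ cong (λ z → (0ℚ - ℕtoℚ 1) + (0ℚ * (0ℚ - ℕtoℚ 1) + z)) (sym (elimination-non-leader 0 i i< li)) ⟩
        M₂ (suc i) 0 + (0ℚ * M₂ (suc i) 0 + elimination 0 (suc i)) ∎
      where open ≡-Reasoning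
    ... | true = begin
        - size (blk i)
          ≡⟨ cong -_ (blockSize≡1+ i i<) ⟩
        - (1ℚ + q)
          ≡⟨ solve 1 (λ q → :- (con 1ℚ :+ q) := (con 0ℚ :- con (ℕtoℚ 1)) :+ (con 0ℚ :* (con 0ℚ :- con (ℕtoℚ 1)) :+ q :* con c)) refl q ⟩
        (0ℚ - ℕtoℚ 1) + (0ℚ * (0ℚ - ℕtoℚ 1) + q * c)
          ≡⟨ cong (λ z → (0ℚ - ℕtoℚ 1) + (0ℚ * (0ℚ - ℕtoℚ 1) + z)) (sym (elimination-leader 0 i i< li c (λ _ _ _ → refl))) ⟩
        M₂ (suc i) 0 + (0ℚ * M₂ (suc i) 0 + elimination 0 (suc i)) ∎
      where
      open ≡-Reasoning
      q = ℕtoℚ (blockSize ns (blk i) ∸ 1)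
      c : ℚ
      c = - (0ℚ - ℕtoℚ 1) * - 1ℚ

    sameBlock : ℕ → ℕ → ℚ
    sameBlock i j = if blk i ≡ᵇ blk j then 1ℚ else 0ℚ

    M₂-leader : ∀ r j → lead j ≡ true → M₂ r (suc j) ≡ M₁ r (suc j)
    M₂-leader r j lj = cong (λ b → if b then M₁ r (suc j) else nonLeaderColumn r j) lj

    M₃-leader : ∀ i j → lead j ≡ true → M₃ (suc i) (suc j) ≡ (if i ≡ᵇ j then pole (blk j) else 0ℚ)
    M₃-leader i j lj = cong (λ b → if b then (if i ≡ᵇ j then pole (blk j) else 0ℚ) else nonLeaderColumn (suc i) j) lj

    leader-column-eliminated : ∀ r j → r ℕ.< suc n′ → j ℕ.< n′ → lead j ≡ true → EliminationStep r (suc j)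
    leader-column-eliminated zero j _ j< lj = begin
        M₃ 0 (suc j)
          ≡⟨ cong (λ b → if b then - (two * x + 1ℚ) else nonLeaderColumn 0 j) lj ⟩
        - (two * x + 1ℚ)
          ≡⟨ solve 2 (λ x a → :- (con two :* x :+ con 1ℚ) := :- (con two :* x :+ con 1ℚ) :+ (con 0ℚ :* a :+ con 0ℚ)) refl x (M₂ 0 0) ⟩
        - (two * x + 1ℚ) + (0ℚ * M₂ 0 0 + 0ℚ)
          ≡⟨ cong₂ (λ u z → u + (0ℚ * M₂ 0 0 + z)) (sym (M₂-leader 0 j lj)) (sym (elimination-row0 (suc j))) ⟩
        M₂ 0 (suc j) + (0ℚ * M₂ 0 0 + elimination (suc j) 0) ∎
      where open ≡-Reasoning
    leader-column-eliminated (suc i) j (s≤s i<) j< lj with lead i in li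
    ... | false = begin
        M₃ (suc i) (suc j)
          ≡⟨ trans (M₃-leader i j lj) (cong (λ b → if b then pole (blk j) else 0ℚ) (≢⇒≡ᵇ-false i≢j)) ⟩
        0ℚ
          ≡⟨ solve 2 (λ a v → con 0ℚ := v :+ (con 0ℚ :* a :+ :- v :* con 1ℚ)) refl (M₂ (suc i) 0) v ⟩
        v + (0ℚ * M₂ (suc i) 0 + - v * 1ℚ)
          ≡⟨ cong (λ u → u + (0ℚ * M₂ (suc i) 0 + - u * 1ℚ)) (sym M₂≡v) ⟩
        M₂ (suc i) (suc j) + (0ℚ * M₂ (suc i) 0 + - M₂ (suc i) (suc j) * 1ℚ)
          ≡⟨ cong (λ z → M₂ (suc i) (suc j) + (0ℚ * M₂ (suc i) 0 + z)) (sym (elimination-non-leader (suc j) i i< li)) ⟩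
        M₂ (suc i) (suc j) + (0ℚ * M₂ (suc i) 0 + elimination (suc j) (suc i)) ∎
      where
      open ≡-Reasoning
      v = sameBlock i j
      i≢j : i ≢ j
      i≢j = leader≢non-leader lj li ∘ sym
      M₂≡v : M₂ (suc i) (suc j) ≡ v
      M₂≡v = trans (M₂-leader (suc i) j lj) (cong (λ b → if b then x + two else v) (≢⇒≡ᵇ-false i≢j))
    ... | true = begin
        M₃ (suc i) (suc j)
          ≡⟨ M₃-leader i j lj ⟩
        (if i ≡ᵇ j then pole (blk j) else 0ℚ)
          ≡⟨ same-or-other-block (i ℕ.≟ j) ⟩
        M₁ (suc i) (suc j) + (0ℚ * M₂ (suc i) 0 + ℕtoℚ (blockSize ns (blk i) ∸ 1) * v)
          ≡⟨ cong₂ (λ u z → u + (0ℚ * M₂ (suc i) 0 + z)) (sym (M₂-leader (suc i) j lj))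
                   (sym (elimination-leader (suc j) i i< li v block-entry)) ⟩
        M₂ (suc i) (suc j) + (0ℚ * M₂ (suc i) 0 + elimination (suc j) (suc i)) ∎
      where
      open ≡-Reasoning
      v = sameBlock i j
      block-entry : ∀ k → lead k ≡ false → blk k ≡ blk i → - M₂ (suc k) (suc j) * - 1ℚ ≡ v
      block-entry k lk same rewrite lj | ≢⇒≡ᵇ-false (leader≢non-leader lj lk ∘ sym) | same =
        solve 1 (λ v → :- v :* (:- con 1ℚ) := v) refl v
      same-or-other-block : Dec (i ≡ j) →
        (if i ≡ᵇ j then pole (blk j) else 0ℚ)
          ≡ M₁ (suc i) (suc j) + (0ℚ * M₂ (suc i) 0 + ℕtoℚ (blockSize ns (blk i) ∸ 1) * v)
      same-or-other-block (yes refl) rewrite ≡ᵇ-refl i | ≡ᵇ-refl (blk i) | blockSize≡1+ i i< =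
        solve 3 (λ x q a → x :+ (con 1ℚ :+ q) :+ con 1ℚ := (x :+ con two) :+ (con 0ℚ :* a :+ q :* con 1ℚ))
          refl x (ℕtoℚ (blockSize ns (blk i) ∸ 1)) (M₂ (suc i) 0)
      same-or-other-block (no i≢j) rewrite ≢⇒≡ᵇ-false i≢j | ≢⇒≡ᵇ-false (leaders-in-different-blocks i j i< j< li lj i≢j) =
        solve 2 (λ q a → con 0ℚ := con 0ℚ :+ (con 0ℚ :* a :+ q :* con 0ℚ)) refl (ℕtoℚ (blockSize ns (blk i) ∸ 1)) (M₂ (suc i) 0)

  det-M₃ : det (suc n′) (matrix M₃) ≡ det (suc n′) (matrix M₂)
  det-M₃ = det-add-kept-column-combinationsℕ (suc n′) M₂ M₃ isNonLeaderColumn eliminated kept changed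
    where
    kept : ∀ r c → r ℕ.< suc n′ → c ℕ.< suc n′ → isNonLeaderColumn c ≡ true → M₃ r c ≡ M₂ r c
    kept r (suc j) _ _ non-leader = trans (M₃-non-leader r) (sym (M₂-non-leader r))
      where
      lj : lead j ≡ false
      lj = trans (sym (not-involutive (lead j))) (cong not non-leader)
      M₂-non-leader : ∀ r → M₂ r (suc j) ≡ nonLeaderColumn r j
      M₂-non-leader r = cong (λ b → if b then M₁ r (suc j) else nonLeaderColumn r j) lj
      M₃-non-leader : ∀ r → M₃ r (suc j) ≡ nonLeaderColumn r j
      M₃-non-leader zero    = cong (λ b → if b then - (two * x + 1ℚ) else nonLeaderColumn 0 j) lj
      M₃-non-leader (suc i) = cong (λ b → if b then (if i ≡ᵇ j then pole (blk j) else 0ℚ) else nonLeaderColumn (suc i) j) lj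
    changed : ∀ r c → r ℕ.< suc n′ → c ℕ.< suc n′ → isNonLeaderColumn c ≡ false → EliminationStep r c
    changed r zero    r< _ _ = column0-eliminated r r<
    changed r (suc j) r< (s≤s j<) leader =
      leader-column-eliminated r j r< j< (trans (sym (not-involutive (lead j))) (cong not leader))

  -- A total inverse, junk (0) at 0; it is only applied to the nonzero poles.
  inverse : ℚ → ℚ
  inverse q with q ≟ℚ 0ℚ
  ... | yes _  = 0ℚ
  ... | no q≢0 = (1/ q) {{≢-nonZero q≢0}}

  inverse≡1/ : ∀ q (q≢0 : q ≢ 0ℚ) → inverse q ≡ (1/ q) {{≢-nonZero q≢0}}
  inverse≡1/ q q≢0 with q ≟ℚ 0ℚ
  ... | yes q≡0 = ⊥-elim (q≢0 q≡0)
  ... | no _    = refl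

  inverse-inverseˡ : ∀ q → q ≢ 0ℚ → inverse q * q ≡ 1ℚ
  inverse-inverseˡ q q≢0 = trans (cong (_* q) (inverse≡1/ q q≢0)) (*-inverseˡ q {{≢-nonZero q≢0}})

  private
    isLeaderColumn : ℕ → Bool
    isLeaderColumn zero    = false
    isLeaderColumn (suc k) = lead k

    leaderWeight : ℕ → ℕ → ℚ
    leaderWeight zero (suc k) = size (blk k) * inverse (pole (blk k))
    leaderWeight _    _       = 0ℚ

  -- Clearing the leader rows of column 0 by the leader columns.
  M₄ : ℕ → ℕ → ℚ
  M₄ r       (suc j) = M₃ r (suc j)
  M₄ zero    zero    = M₃ 0 0 + sumℕ (suc n′) (λ k → (if isLeaderColumn k then leaderWeight 0 k else 0ℚ) * M₃ 0 k)
  M₄ (suc i) zero    = 0ℚ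

  module _ (poles : All (Pole x) ns) where

    pole≢0 : ∀ i → i ℕ.< n′ → pole (blk i) ≢ 0ℚ
    pole≢0 i i< = All-blockSize ns poles i i<

    private
      row-cleared : ∀ i → i ℕ.< n′ →
        0ℚ ≡ M₃ (suc i) 0 + (0ℚ * M₃ (suc i) 0 + sumℕ n′ (λ k → (if lead k then leaderWeight 0 (suc k) else 0ℚ) * M₃ (suc i) (suc k)))
      row-cleared i i< with lead i in li
      ... | false = sym (trans (cong (λ z → 0ℚ + (0ℚ * 0ℚ + z)) (sumℕ-zero n′ vanishes)) refl)
        where
        vanishes : ∀ k → k ℕ.< n′ → (if lead k then leaderWeight 0 (suc k) else 0ℚ) * M₃ (suc i) (suc k) ≡ 0ℚ
        vanishes k _ with lead k in lk
        ... | false = *-zeroˡ (nonLeaderColumn (suc i) k)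
        ... | true rewrite ≢⇒≡ᵇ-false (leader≢non-leader lk li ∘ sym) = *-zeroʳ (leaderWeight 0 (suc k))
      ... | true = begin
          0ℚ
            ≡⟨ solve 1 (λ s → con 0ℚ := :- s :+ (con 0ℚ :* (:- s) :+ s)) refl (size (blk i)) ⟩
          - size (blk i) + (0ℚ * - size (blk i) + size (blk i))
            ≡⟨ cong (λ z → - size (blk i) + (0ℚ * - size (blk i) + z)) (sym (trans (sumℕ-single n′ i i< others) at-i)) ⟩
          - size (blk i) + (0ℚ * - size (blk i) + sumℕ n′ g) ∎
        where
        open ≡-Reasoning
        g : ℕ → ℚ
        g k = (if lead k then leaderWeight 0 (suc k) else 0ℚ) * M₃ (suc i) (suc k)
        others : ∀ k → k ℕ.< n′ → k ≢ i → g k ≡ 0ℚ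
        others k _ k≢i with lead k
        ... | false = *-zeroˡ (nonLeaderColumn (suc i) k)
        ... | true rewrite ≢⇒≡ᵇ-false (k≢i ∘ sym) = *-zeroʳ (leaderWeight 0 (suc k))
        at-i : g i ≡ size (blk i)
        at-i rewrite li | ≡ᵇ-refl i =
          trans (*-assoc (size (blk i)) (inverse (pole (blk i))) (pole (blk i)))
                (trans (cong (size (blk i) *_) (inverse-inverseˡ (pole (blk i)) (pole≢0 i i<))) (*-identityʳ (size (blk i))))

    det-M₄ : det (suc n′) (matrix M₄) ≡ det (suc n′) (matrix M₃)
    det-M₄ = det-add-kept-column-combinationsℕ (suc n′) M₃ M₄ isLeaderColumn leaderWeight kept changed
      where
      kept : ∀ r c → r ℕ.< suc n′ → c ℕ.< suc n′ → isLeaderColumn c ≡ true → M₄ r c ≡ M₃ r c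
      kept r (suc j) _ _ _ = refl
      changed : ∀ r c → r ℕ.< suc n′ → c ℕ.< suc n′ → isLeaderColumn c ≡ false →
        M₄ r c ≡ M₃ r c + sumℕ (suc n′) (λ k → (if isLeaderColumn k then leaderWeight c k else 0ℚ) * M₃ r k)
      changed zero    zero _        _ _ = refl
      changed (suc i) zero (s≤s i<) _ _ = row-cleared i i<
      changed r (suc j) _ _ _ = trans (sym (+-identityʳ (M₃ r (suc j))))
        (cong (M₃ r (suc j) +_) (sym (sumℕ-zero (suc n′) (λ k _ → no-weight k))))
        where
        no-weight : ∀ k → (if isLeaderColumn k then 0ℚ else 0ℚ) * M₃ r k ≡ 0ℚ
        no-weight k with isLeaderColumn k
        ... | true  = *-zeroˡ (M₃ r k)
        ... | false = *-zeroˡ (M₃ r k)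

    M₄-upper : ∀ r c → r ℕ.< suc n′ → c ℕ.< r → M₄ r c ≡ 0ℚ
    M₄-upper (suc i) zero    _        _         = refl
    M₄-upper (suc i) (suc j) (s≤s i<) (s≤s j<i) with lead j
    ... | true  rewrite ≢⇒≡ᵇ-false (ℕP.<⇒≢ j<i ∘ sym) = refl
    ... | false rewrite ≢⇒≡ᵇ-false (ℕP.<⇒≢ j<i ∘ sym)
                      | ≢⇒≡ᵇ-false (ℕP.<⇒≢ (ℕP.≤-<-trans (leader-≤ ns j (ℕP.<-trans j<i i<)) j<i) ∘ sym) = refl

    private
      diagonal : Bool → ℕ → ℚ
      diagonal b l = if b then pole l else 1ℚ

      M₄-diagonal : ∀ i → M₄ (suc i) (suc i) ≡ diagonal (lead i) (blk i)
      M₄-diagonal i with lead i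
      ... | true  rewrite ≡ᵇ-refl i = refl
      ... | false rewrite ≡ᵇ-refl i = refl

      blockProd-poles : ∀ ms → blockProd ms (λ b l → if b then x + ℕtoℚ (blockSize ms l) + 1ℚ else 1ℚ) ≡ prodPoles x ms
      blockProd-poles []       = refl
      blockProd-poles (m ∷ ms) =
        trans (cong₂ (λ u v → (x + ℕtoℚ m + 1ℚ) * u * v) (trans (prodℕ-const (m ∸ 1) 1ℚ) (1^ᵠn (m ∸ 1))) (blockProd-poles ms))
              (cong (_* prodPoles x ms) (*-identityʳ (x + ℕtoℚ m + 1ℚ)))

      fraction : List ℕ → Bool → ℕ → ℚ
      fraction ms b l = if b then ℕtoℚ (blockSize ms l) * inverse (x + ℕtoℚ (blockSize ms l) + 1ℚ) * (- (two * x + 1ℚ)) else 0ℚ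

      blockSum-fractions : ∀ ms (ps : All (Pole x) ms) → blockSum ms (fraction ms) ≡ - fracSum x ms ps
      blockSum-fractions []       []       = refl
      blockSum-fractions (m ∷ ms) (p ∷ ps) = begin
          ℕtoℚ m * inverse D * (- (two * x + 1ℚ)) + sumℕ (m ∸ 1) (λ _ → 0ℚ) + blockSum ms (fraction ms)
            ≡⟨ cong₂ (λ u v → ℕtoℚ m * u * (- (two * x + 1ℚ)) + v + blockSum ms (fraction ms))
                     (inverse≡1/ D p) (sumℕ-zero (m ∸ 1) (λ _ _ → refl)) ⟩
          ℕtoℚ m * D⁻¹ * (- (two * x + 1ℚ)) + 0ℚ + blockSum ms (fraction ms)
            ≡⟨ cong (ℕtoℚ m * D⁻¹ * (- (two * x + 1ℚ)) + 0ℚ +_) (blockSum-fractions ms ps) ⟩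
          ℕtoℚ m * D⁻¹ * (- (two * x + 1ℚ)) + 0ℚ + - fracSum x ms ps
            ≡⟨ solve 4 (λ a i x f → a :* i :* (:- (con two :* x :+ con 1ℚ)) :+ con 0ℚ :+ :- f := :- (a :* (con two :* x :+ con 1ℚ) :* i :+ f))
                       refl (ℕtoℚ m) D⁻¹ x (fracSum x ms ps) ⟩
          - (ℕtoℚ m * (two * x + 1ℚ) * D⁻¹ + fracSum x ms ps) ∎
        where
        open ≡-Reasoning
        D = x + ℕtoℚ m + 1ℚ
        D⁻¹ = (1/ D) {{≢-nonZero p}}

      M₄-corner : M₄ 0 0 ≡ x - fracSum x ns poles
      M₄-corner = begin
          (x - ℕtoℚ 0) + (0ℚ * (x - ℕtoℚ 0) + sumℕ n′ g)
            ≡⟨ cong (λ z → (x - ℕtoℚ 0) + (0ℚ * (x - ℕtoℚ 0) + z))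
                    (trans (sumℕ-cong n′ (λ k _ → by-block k)) (trans (sumℕ-by-blocks ns ns≥1 (fraction ns)) (blockSum-fractions ns poles))) ⟩
          (x - ℕtoℚ 0) + (0ℚ * (x - ℕtoℚ 0) + - fracSum x ns poles)
            ≡⟨ solve 2 (λ x f → (x :- con (ℕtoℚ 0)) :+ (con 0ℚ :* (x :- con (ℕtoℚ 0)) :+ :- f) := x :- f) refl x (fracSum x ns poles) ⟩
          x - fracSum x ns poles ∎
        where
        open ≡-Reasoning
        g : ℕ → ℚ
        g k = (if lead k then leaderWeight 0 (suc k) else 0ℚ) * M₃ 0 (suc k)
        by-block : ∀ k → g k ≡ fraction ns (lead k) (blk k)
        by-block k with lead k
        ... | true  = refl
        ... | false = *-zeroˡ 0ℚ

    det-M₄-triangular : det (suc n′) (matrix M₄) ≡ (x - fracSum x ns poles) * prodPoles x ns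
    det-M₄-triangular = trans (det-upper-triangularℕ (suc n′) M₄ M₄-upper)
      (cong₂ _*_ M₄-corner
             (trans (prodℕ-cong n′ (λ k _ → M₄-diagonal k))
                    (trans (prodℕ-by-blocks ns ns≥1 diagonal) (blockProd-poles ns))))

  private
    length≤sum : ∀ ms → All (1 ℕ.≤_) ms → length ms ℕ.≤ sum ms
    length≤sum []       []       = z≤n
    length≤sum (m ∷ ms) (p ∷ ps) = ℕP.+-mono-≤ p (length≤sum ms ps)

    blockProd-scale : ∀ ms → All (1 ℕ.≤_) ms → blockProd ms (λ b _ → if b then 1ℚ else μ) ≡ μ ^ᵠ (sum ms ∸ length ms)
    blockProd-scale []            []       = refl
    blockProd-scale (suc m ∷ ms) (_ ∷ ps) = begin
        1ℚ * prodℕ m (λ _ → μ) * blockProd ms (λ b _ → if b then 1ℚ else μ)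
          ≡⟨ cong₂ (λ u v → 1ℚ * u * v) (prodℕ-const m μ) (blockProd-scale ms ps) ⟩
        1ℚ * μ ^ᵠ m * μ ^ᵠ (sum ms ∸ length ms)
          ≡⟨ cong (_* μ ^ᵠ (sum ms ∸ length ms)) (*-identityˡ (μ ^ᵠ m)) ⟩
        μ ^ᵠ m * μ ^ᵠ (sum ms ∸ length ms)
          ≡⟨ sym (^ᵠ-+ μ m (sum ms ∸ length ms)) ⟩
        μ ^ᵠ (m ℕ.+ (sum ms ∸ length ms))
          ≡⟨ cong (μ ^ᵠ_) (sym (ℕP.+-∸-assoc m (length≤sum ms ps))) ⟩
        μ ^ᵠ (m ℕ.+ sum ms ∸ length ms) ∎
      where open ≡-Reasoning

  3≤n : 2 ℕ.≤ length ns → 3 ℕ.≤ suc n′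
  3≤n 2≤k = s≤s (ℕP.≤-trans 2≤k (length≤sum ns ns≥1))

  scale-product : prodℕ (suc n′) scale ≡ μ ^ᵠ (suc n′ ∸ length ns ∸ 1)
  scale-product = begin
      1ℚ * prodℕ n′ (λ j → scale (suc j))    ≡⟨ *-identityˡ _ ⟩
      prodℕ n′ (λ j → scale (suc j))         ≡⟨ prodℕ-by-blocks ns ns≥1 (λ b _ → if b then 1ℚ else μ) ⟩
      blockProd ns (λ b _ → if b then 1ℚ else μ) ≡⟨ blockProd-scale ns ns≥1 ⟩
      μ ^ᵠ (n′ ∸ length ns)                  ≡⟨ cong (μ ^ᵠ_) (sym (trans (ℕP.∸-+-assoc (suc n′) (length ns) 1) (cong (suc n′ ∸_) (ℕP.+-comm (length ns) 1)))) ⟩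
      μ ^ᵠ (suc n′ ∸ length ns ∸ 1)          ∎
    where open ≡-Reasoning

lemma3p4 : (ns : List ℕ) → 2 ≤ length ns → All (1 ≤_) ns →
    (λ' : ℚ) → (poles : All (Pole λ') ns) →
    charPolyD ns λ'
      ≡ ((λ' + 1ℚ) ^ᵠ ((suc (sum ns)) ∸ length ns ∸ 1))
        * (λ' - fracSum λ' ns poles)
        * prodPoles λ' ns
lemma3p4 ns 2≤k ns≥1 λ' poles = begin
    charPolyD ns λ'                                        ≡⟨ charPolyD≡det-charMatrix ns λ' (3≤n 2≤k) ⟩
    det n (matrix M₀)                                      ≡⟨ sym det-M₁ ⟩
    det n (matrix M₁)                                      ≡⟨ det-M₁≡scale*det-M₂ ⟩
    prodℕ n scale * det n (matrix M₂)                      ≡⟨ cong₂ _*_ scale-product (sym det-M₃) ⟩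
    μ ^ᵠ (n ∸ length ns ∸ 1) * det n (matrix M₃)          ≡⟨ cong (μ ^ᵠ (n ∸ length ns ∸ 1) *_) (trans (sym (det-M₄ poles)) (det-M₄-triangular poles)) ⟩
    μ ^ᵠ (n ∸ length ns ∸ 1) * ((λ' - fracSum λ' ns poles) * prodPoles λ' ns)
                                                           ≡⟨ sym (*-assoc (μ ^ᵠ (n ∸ length ns ∸ 1)) (λ' - fracSum λ' ns poles) (prodPoles λ' ns)) ⟩
    μ ^ᵠ (n ∸ length ns ∸ 1) * (λ' - fracSum λ' ns poles) * prodPoles λ' ns ∎
  where
  open ≡-Reasoning
  open Reduction ns λ' ns≥1
  n = suc (sum ns)
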